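{- For $n\ge1$ let $a_n=|\mathfrak{S}_n^{\nearrow}(132)|$, i.e. the number of nom codes $f\in F_n^{\nearrow}$ such that $\phi(f)$ avoids $132$, and let $p_m$ denote the number of integer partitions of $m$. Then $a_1=1$ and $a_n=a_{n-1}+p_{n-1}$ for all $n\ge 2$.
   Context: $[n]=\{1,\dots,n\}$, $\mathfrak{S}_n$ the symmetric group on $[n]$; products of permutations are composed with the leftmost factor acting first: $(\alpha\beta)(x)=\beta(\alpha(x))$. A function $f:[n]\to[n]$ is subexceedant if $1\le f(i)\le i$ for all $i$, written $f_1\cdots f_n$; $F_n$ is the set of such functions. $\phi:F_n\to\mathfrak{S}_n$, $\phi(f)=(1,f_1)(2,f_2)\cdots(n,f_n)$ (with $(i,i)$ the identity), is a bijection; $\phi^{ -1}(\sigma)$ is the nom code of $\sigma$. $F_n^{\nearrow}$ is the set of non-decreasing subexceedant functions on $[n]$, $\mathfrak{S}_n^{\nearrow}=\phi(F_n^{\nearrow})$. A permutation $\sigma$ contains a pattern $\pi\in\mathfrak{S}_3$ if there are $a<b<c$ with $\sigma(a)\sigma(b)\sigma(c)$ in the same relative order as $\pi(1)\pi(2)\pi(3)$, and avoids it otherwise; $\mathfrak{S}_n^{\nearrow}(\pi)$ is the set of $\sigma\in\mathfrak{S}_n^{\nearrow}$ avoiding $\pi$. -}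

module Defs where

open import Data.Nat using (ℕ; zero; suc; _+_; _≤_; _<_; _≥_; _≡ᵇ_)
open import Data.Unit using (⊤)
open import Data.Bool using (if_then_else_)
open import Data.List using (List; []; _∷_; length)
open import Data.Nat.ListAction using (sum)
open import Data.List.Relation.Unary.Linked using (Linked)
open import Data.List.Relation.Unary.All using (All)
open import Data.List.Relation.Unary.Unique.Propositional using (Unique)
open import Data.List.Membership.Propositional using (_∈_)
open import Data.Product using (Σ; _×_; ∃-syntax)
open import Function.Bundles using (_⇔_)
open import Relation.Nullary using (¬_)
open import Relation.Binary.PropositionalEquality using (_≡_)

-- A function f : [n] → [n] is encoded as the list f₁ ⋯ fₙ (length n).

SubexcFrom : ℕ → List ℕ → Set
SubexcFrom i []       = ⊤
SubexcFrom i (x ∷ xs) = (1 ≤ x × x ≤ i) × SubexcFrom (suc i) xs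

Subexceedant : ℕ → List ℕ → Set
Subexceedant n f = length f ≡ n × SubexcFrom 1 f

NonDecSubexceedant : ℕ → List ℕ → Set
NonDecSubexceedant n f = Subexceedant n f × Linked _≤_ f

swap : ℕ → ℕ → ℕ → ℕ
swap a b x = if x ≡ᵇ a then b else (if x ≡ᵇ b then a else x)

-- (i,f_i)(i+1,f_{i+1})⋯ applied to x, leftmost factor acting first
φFrom : ℕ → List ℕ → ℕ → ℕ
φFrom i []       x = x
φFrom i (y ∷ ys) x = φFrom (suc i) ys (swap i y x)

-- φ(f) = (1,f₁)(2,f₂)⋯(n,fₙ), as a function on ℕ (it permutes [n])
φ : List ℕ → ℕ → ℕ
φ f = φFrom 1 f

Contains132 : ℕ → (ℕ → ℕ) → Set
Contains132 n σ = ∃[ a ] ∃[ b ] ∃[ c ]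
  (1 ≤ a × a < b × b < c × c ≤ n × σ a < σ c × σ c < σ b)

Avoids132 : ℕ → (ℕ → ℕ) → Set
Avoids132 n σ = ¬ Contains132 n σ

NomCode132 : ℕ → List ℕ → Set
NomCode132 n f = NonDecSubexceedant n f × Avoids132 n (φ f)

Partition : ℕ → List ℕ → Set
Partition m λs = All (λ x → 1 ≤ x) λs × Linked _≥_ λs × sum λs ≡ m

HasCard : (List ℕ → Set) → ℕ → Set
HasCard P k = Σ (List (List ℕ)) λ xs →
  Unique xs × length xs ≡ k × ((f : List ℕ) → (f ∈ xs) ⇔ P f)

{-# OPTIONS --safe #-}
module Submission where

open import Defs
open import Data.Nat using (ℕ; zero; suc; pred; _+_; _≤_; _<_; _≡ᵇ_; z≤n; s≤s; _∸_)
open import Data.Nat.Properties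
open import Data.Nat.ListAction using (sum)
open import Data.Nat.ListAction.Properties using (sum-↭)
open import Data.Nat.Tactic.RingSolver using (solve-∀)
open import Data.Bool using (true; false; T; if_then_else_)
open import Data.Unit using (tt)
open import Data.Empty using (⊥; ⊥-elim)
open import Data.Sum using (_⊎_; inj₁; inj₂)
open import Data.Product using (Σ; _×_; _,_; proj₁; proj₂; ∃-syntax)
open import Data.List using (List; []; _∷_; length; _++_; _∷ʳ_; replicate; foldl; reverse; map)
open import Data.List.Base using (reverseAcc)
open import Data.List.Properties using (foldl-∷ʳ; ∷ʳ-injective; length-++; length-map; reverse-injective; reverse-involutive)
open import Data.List.Relation.Unary.Linked using (Linked; []; [-]; _∷_)
import Data.List.Relation.Unary.Linked as Linked
open import Data.List.Relation.Unary.All using (All; []; _∷_)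
open import Data.List.Relation.Unary.AllPairs using ([]; _∷_)
open import Data.List.Relation.Unary.Any using (here; there)
open import Data.List.Relation.Unary.Unique.Propositional using (Unique)
import Data.List.Relation.Unary.Unique.Propositional.Properties as Unique
open import Data.List.Relation.Binary.Permutation.Propositional using (↭-sym)
open import Data.List.Relation.Binary.Permutation.Propositional.Properties using (↭-reverse; All-resp-↭)
open import Data.List.Membership.Propositional using (_∈_)
open import Data.List.Membership.Propositional.Properties using (∈-map⁺; ∈-map⁻; ∈-++⁺ˡ; ∈-++⁺ʳ; ∈-++⁻)
open import Function.Bundles using (_⇔_; mk⇔; Equivalence)
open import Relation.Binary.PropositionalEquality
open import Relation.Nullary using (¬_; yes; no)
open import Function using (_∘_; flip)

-- Write σ = φ(f) for a code f of length N.  Appending a letter k ≤ N + 1 post-composes σ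
-- with the transposition (N+1 k): the position holding the value k now holds N + 1, and
-- the new position N + 1 holds k.  As codes are non-decreasing, all later letters are ≥ k,
-- so a 132 whose "1" has a value below the last letter survives every extension.  Hence a
-- non-decreasing code either ends in the fixed point N (and then avoids 132 iff its prefix
-- does), or contains such a persistent 132, or σ has one of two rigid shapes: the cycle
-- 1 ↦ 2 ↦ ⋯ ↦ N ↦ 1 of the code 1 ⋯ 1, or a two-block shape in which positions 1..x carry
-- the values a+y+1..a+y+x, positions x+1..x+y the values a+1..a+y, all later positions
-- values ≤ a, and a = σ(N) is the last letter.  From a two-block shape the only letters
-- that neither end in N + 1 nor create a persistent 132 are a + 1, which lets the current
-- part of a partition grow while it is smaller than the previous part, and a + y + 1, which
-- starts a new part.  Building a partition of N - 1 from its largest part down thus gives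
-- a bijection onto the codes avoiding 132 that do not end in N; it is inverted by reading
-- the letters back.

≡ᵇ-refl : ∀ n → (n ≡ᵇ n) ≡ true
≡ᵇ-refl zero = refl
≡ᵇ-refl (suc n) = ≡ᵇ-refl n

≢⇒≡ᵇ-false : ∀ {m n} → m ≢ n → (m ≡ᵇ n) ≡ false
≢⇒≡ᵇ-false {zero} {zero} m≢n = ⊥-elim (m≢n refl)
≢⇒≡ᵇ-false {zero} {suc n} _ = refl
≢⇒≡ᵇ-false {suc m} {zero} _ = refl
≢⇒≡ᵇ-false {suc m} {suc n} m≢n = ≢⇒≡ᵇ-false (m≢n ∘ cong suc)

swap-hitˡ : ∀ a b → swap a b a ≡ b
swap-hitˡ a b rewrite ≡ᵇ-refl a = refl

swap-hitʳ : ∀ a b → swap a b b ≡ a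
swap-hitʳ a b with b ≡ᵇ a in eq
... | true = ≡ᵇ⇒≡ b a (subst T (sym eq) tt)
... | false rewrite ≡ᵇ-refl b = refl

swap-miss : ∀ a b x → x ≢ a → x ≢ b → swap a b x ≡ x
swap-miss a b x x≢a x≢b rewrite ≢⇒≡ᵇ-false x≢a | ≢⇒≡ᵇ-false x≢b = refl

swap-diag : ∀ a x → swap a a x ≡ x
swap-diag a x with x ≡ᵇ a in eq
... | true = sym (≡ᵇ⇒≡ x a (subst T (sym eq) tt))
... | false = refl

φFrom-∷ʳ : ∀ i xs y x → φFrom i (xs ∷ʳ y) x ≡ swap (length xs + i) y (φFrom i xs x)
φFrom-∷ʳ i [] y x = refl
φFrom-∷ʳ i (z ∷ zs) y x rewrite φFrom-∷ʳ (suc i) zs y (swap i z x) | +-suc (length zs) i = refl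

φ-∷ʳ : ∀ xs y x → φ (xs ∷ʳ y) x ≡ swap (suc (length xs)) y (φ xs x)
φ-∷ʳ xs y x rewrite φFrom-∷ʳ 1 xs y x | +-comm (length xs) 1 = refl

BoundedBy : (ℕ → ℕ) → ℕ → Set
BoundedBy σ N = ∀ i → 1 ≤ i → i ≤ N → σ i ≤ N

FixedAbove : (ℕ → ℕ) → ℕ → Set
FixedAbove σ N = ∀ j → N < j → σ j ≡ j

Occurs132Below : (ℕ → ℕ) → ℕ → ℕ → Set
Occurs132Below σ N L = ∃[ a ] ∃[ b ] ∃[ c ]
  (1 ≤ a × a < b × b < c × c ≤ N × σ a < σ c × σ c < σ b × σ a < L)

occurs132Below⇒contains : ∀ {σ N L} → Occurs132Below σ N L → Contains132 N σ
occurs132Below⇒contains (a , b , c , h₁ , h₂ , h₃ , h₄ , h₅ , h₆ , _) = a , b , c , h₁ , h₂ , h₃ , h₄ , h₅ , h₆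

extend : ℕ → ℕ → (ℕ → ℕ) → ℕ → ℕ
extend N k σ i = swap (suc N) k (σ i)

extend-φ : ∀ g k N → length g ≡ N → extend N k (φ g) ≗ φ (g ∷ʳ k)
extend-φ g k N refl i = sym (φ-∷ʳ g k i)

data ExtendView (N k v : ℕ) : Set where
  hit  : v ≡ k → swap (suc N) k v ≡ suc N → ExtendView N k v
  miss : v ≢ k → swap (suc N) k v ≡ v → ExtendView N k v

extend-view : ∀ N k v → v ≤ N → ExtendView N k v
extend-view N k v v≤N with v ≟ k
... | yes refl = hit refl (swap-hitʳ (suc N) v)
... | no v≢k = miss v≢k (swap-miss (suc N) k v (λ e → <-irrefl e (s≤s v≤N)) v≢k)

extend-top : ∀ N k σ → σ (suc N) ≡ suc N → extend N k σ (suc N) ≡ k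
extend-top N k σ e rewrite e = swap-hitˡ (suc N) k

extend-hit : ∀ N k σ i → σ i ≡ k → extend N k σ i ≡ suc N
extend-hit N k σ i e rewrite e = swap-hitʳ (suc N) k

extend-miss : ∀ N k σ i → σ i ≤ N → σ i ≢ k → extend N k σ i ≡ σ i
extend-miss N k σ i σi≤N σi≢k = swap-miss (suc N) k (σ i) (λ e → <-irrefl e (s≤s σi≤N)) σi≢k

boundedBy-extend : ∀ {σ N} k → k ≤ suc N → BoundedBy σ N → FixedAbove σ N → BoundedBy (extend N k σ) (suc N)
boundedBy-extend {σ} {N} k k≤ bd fx i 1≤i i≤ with i ≟ suc N
... | yes refl rewrite extend-top N k σ (fx (suc N) ≤-refl) = k≤
... | no i≢ with extend-view N k (σ i) (bd i 1≤i (≤-pred (≤∧≢⇒< i≤ i≢)))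
...   | hit _ e = ≤-reflexive e
...   | miss _ e rewrite e = m≤n⇒m≤1+n (bd i 1≤i (≤-pred (≤∧≢⇒< i≤ i≢)))

fixedAbove-extend : ∀ {σ N} k → k ≤ suc N → FixedAbove σ N → FixedAbove (extend N k σ) (suc N)
fixedAbove-extend {σ} {N} k k≤ fx j lt rewrite fx j (<-trans (n<1+n N) lt) =
  swap-miss (suc N) k j (λ e → <-irrefl (sym e) lt) (λ e → <-irrefl (sym e) (≤-<-trans k≤ lt))

-- The "1" keeps its value because it is < L ≤ k; if the "2" is hit it moves up to N+1,
-- and if the "3" is hit, position N+1 (value k) becomes the new "3".
occurs132Below-extend : ∀ {σ N L} k → L ≤ k → k ≤ suc N → BoundedBy σ N → FixedAbove σ N
  → Occurs132Below σ N L → Occurs132Below (extend N k σ) (suc N) k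
occurs132Below-extend {σ} {N} {L} k L≤k k≤ bd fx (a , b , c , 1≤a , a<b , b<c , c≤N , ac , cb , aL)
  with extend-view N k (σ a) (bd a 1≤a (<⇒≤ (<-trans a<b (<-≤-trans b<c c≤N))))
     | extend-view N k (σ b) (bd b (≤-trans 1≤a (<⇒≤ a<b)) (<⇒≤ (<-≤-trans b<c c≤N)))
     | extend-view N k (σ c) (bd c (≤-trans 1≤a (<⇒≤ (<-trans a<b b<c))) c≤N)
... | hit ea _ | _ | _ = ⊥-elim (<-irrefl ea (<-≤-trans aL L≤k))
... | miss _ ea | hit eb eb' | miss _ ec =
  a , b , c , 1≤a , a<b , b<c , m≤n⇒m≤1+n c≤N ,
  subst₂ _<_ (sym ea) (sym ec) ac ,
  subst₂ _<_ (sym ec) (sym eb') (<-≤-trans cb (m≤n⇒m≤1+n (bd b (≤-trans 1≤a (<⇒≤ a<b)) (<⇒≤ (<-≤-trans b<c c≤N))))) ,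
  subst (_< k) (sym ea) (<-≤-trans aL L≤k)
... | miss _ ea | hit eb eb' | hit ec _ = ⊥-elim (<-irrefl (trans ec (sym eb)) cb)
... | miss _ ea | miss _ eb | hit ec _ =
  a , b , suc N , 1≤a , a<b , s≤s (<⇒≤ (<-≤-trans b<c c≤N)) , ≤-refl ,
  subst₂ _<_ (sym ea) (sym top) (subst (σ a <_) ec ac) ,
  subst₂ _<_ (sym top) (sym eb) (subst (_< σ b) ec cb) ,
  subst (_< k) (sym ea) (<-≤-trans aL L≤k)
  where top = extend-top N k σ (fx (suc N) ≤-refl)
... | miss _ ea | miss _ eb | miss _ ec =
  a , b , c , 1≤a , a<b , b<c , m≤n⇒m≤1+n c≤N ,
  subst₂ _<_ (sym ea) (sym ec) ac , subst₂ _<_ (sym ec) (sym eb) cb ,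
  subst (_< k) (sym ea) (<-≤-trans aL L≤k)

occurs132Below-new : ∀ {σ N} k p q → 1 ≤ p → p < q → q ≤ N → σ q ≡ k → σ p < k → k ≤ N → FixedAbove σ N
  → Occurs132Below (extend N k σ) (suc N) k
occurs132Below-new {σ} {N} k p q 1≤p p<q q≤N σq≡k σp<k k≤N fx with extend-view N k (σ p) (≤-trans (<⇒≤ σp<k) k≤N)
... | hit e _ = ⊥-elim (<-irrefl e σp<k)
... | miss _ e =
  p , q , suc N , 1≤p , p<q , s≤s q≤N , ≤-refl ,
  subst₂ _<_ (sym e) (sym top) σp<k ,
  subst₂ _<_ (sym top) (sym (trans (cong (swap (suc N) k) σq≡k) (swap-hitʳ (suc N) k))) (s≤s k≤N) ,
  subst (_< k) (sym e) σp<k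
  where top = extend-top N k σ (fx (suc N) ≤-refl)

-- A new 132 must use the top position (as "3", forcing its "2" to lie above k by the
-- first condition) or the position moved to N+1 (as "2", excluded by the second).
avoids132-extend : ∀ {σ N} k → k ≤ suc N → BoundedBy σ N → FixedAbove σ N → Avoids132 N σ
  → (∀ i j → 1 ≤ i → i < j → j ≤ N → k ≤ σ j → k ≤ σ i)
  → (∀ a b c → 1 ≤ a → a < b → b < c → c ≤ N → σ b ≡ k → σ a < σ c → ⊥)
  → Avoids132 (suc N) (extend N k σ)
avoids132-extend {σ} {N} k k≤ bd fx av prefix-above no-new-2 (a , b , c , 1≤a , a<b , b<c , c≤ , ac , cb) with c ≟ suc N
... | yes refl = top-is-3
  where
  b≤N : b ≤ N
  b≤N = ≤-pred b<c
  1≤b = ≤-trans 1≤a (<⇒≤ a<b)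
  top = extend-top N k σ (fx (suc N) ≤-refl)
  k≤σb : k ≤ σ b
  k≤σb with extend-view N k (σ b) (bd b 1≤b b≤N)
  ... | hit e _ = ≤-reflexive (sym e)
  ... | miss _ e = <⇒≤ (subst₂ _<_ top e cb)
  top-is-3 : ⊥
  top-is-3 with extend-view N k (σ a) (bd a 1≤a (<⇒≤ (<-≤-trans a<b b≤N)))
  ... | hit _ e = <-irrefl refl (<-≤-trans (subst₂ _<_ e top ac) k≤)
  ... | miss _ e = <-irrefl refl (<-≤-trans (subst₂ _<_ e top ac) (prefix-above a b 1≤a a<b b≤N k≤σb))
... | no c≢ = below-top
  where
  c≤N = ≤-pred (≤∧≢⇒< c≤ c≢)
  1≤b = ≤-trans 1≤a (<⇒≤ a<b)
  1≤c = ≤-trans 1≤b (<⇒≤ b<c)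
  b≤N = <⇒≤ (<-≤-trans b<c c≤N)
  a≤N = <⇒≤ (<-≤-trans a<b b≤N)
  bounded : BoundedBy (extend N k σ) (suc N)
  bounded = boundedBy-extend k k≤ bd fx
  below-top : ⊥
  below-top with extend-view N k (σ a) (bd a 1≤a a≤N) | extend-view N k (σ b) (bd b 1≤b b≤N)
               | extend-view N k (σ c) (bd c 1≤c c≤N)
  ... | hit _ e | _ | _ = <-irrefl refl (<-≤-trans (subst (_< extend N k σ c) e ac) (bounded c 1≤c (m≤n⇒m≤1+n c≤N)))
  ... | miss _ _ | _ | hit _ e = <-irrefl refl (<-≤-trans (subst (_< extend N k σ b) e cb) (bounded b 1≤b (m≤n⇒m≤1+n b≤N)))
  ... | miss _ ea | hit eb _ | miss _ ec = no-new-2 a b c 1≤a a<b b<c c≤N eb (subst₂ _<_ ea ec ac)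
  ... | miss _ ea | miss _ eb | miss _ ec =
    av (a , b , c , 1≤a , a<b , b<c , c≤N , subst₂ _<_ ea ec ac , subst₂ _<_ ec eb cb)

-- The cycle 1 ↦ 2 ↦ ⋯ ↦ N ↦ 1, which is φ(1 ⋯ 1)

record CycleShape (σ : ℕ → ℕ) (N : ℕ) : Set where
  field
    cycle-pos : 1 ≤ N
    cycle-succ : ∀ i → 1 ≤ i → i < N → σ i ≡ suc i
    cycle-last : σ N ≡ 1
    cycle-fixedAbove : FixedAbove σ N
open CycleShape public

cycle-view : ∀ {σ N} → CycleShape σ N → ∀ i → i ≤ N → (i < N × σ i ≡ suc i ⊎ (i ≡ N × σ i ≡ 1)) ⊎ i ≡ 0
cycle-view C zero _ = inj₂ refl
cycle-view {σ} {N} C (suc i) le with suc i ≟ N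
... | yes refl = inj₁ (inj₂ (refl , cycle-last C))
... | no i≢N = inj₁ (inj₁ (≤∧≢⇒< le i≢N , cycle-succ C (suc i) (s≤s z≤n) (≤∧≢⇒< le i≢N)))

cycle-bounded : ∀ {σ N} → CycleShape σ N → BoundedBy σ N
cycle-bounded {σ} {N} C i 1≤i i≤N with cycle-view C i i≤N
... | inj₁ (inj₁ (lt , e)) rewrite e = lt
... | inj₁ (inj₂ (_ , e)) rewrite e = cycle-pos C
... | inj₂ refl = ⊥-elim (<-irrefl refl 1≤i)

cycle-avoids132 : ∀ {σ N} → CycleShape σ N → Avoids132 N σ
cycle-avoids132 {σ} {N} C (a , b , c , 1≤a , a<b , b<c , c≤N , ac , cb)
  with cycle-view C a (<⇒≤ (<-trans a<b (<-≤-trans b<c c≤N)))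
     | cycle-view C b (<⇒≤ (<-≤-trans b<c c≤N)) | cycle-view C c c≤N
... | inj₂ refl | _ | _ = <-irrefl refl 1≤a
... | _ | inj₂ refl | _ = <-irrefl refl (≤-trans 1≤a (<⇒≤ a<b))
... | _ | _ | inj₂ refl = <-irrefl refl (≤-trans 1≤a (<⇒≤ (<-trans a<b b<c)))
... | inj₁ (inj₂ (refl , _)) | _ | _ = <-irrefl refl (<-≤-trans (<-trans a<b b<c) c≤N)
... | _ | inj₁ (inj₂ (refl , _)) | _ = <-irrefl refl (<-≤-trans b<c c≤N)
... | inj₁ (inj₁ (_ , ea)) | inj₁ (inj₁ (_ , eb)) | inj₁ (inj₂ (_ , ec)) =
  <-irrefl refl (<-≤-trans (subst₂ _<_ ea ec ac) (s≤s z≤n))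
... | inj₁ (inj₁ (_ , ea)) | inj₁ (inj₁ (_ , eb)) | inj₁ (inj₁ (_ , ec)) =
  <-irrefl refl (<-trans (subst₂ _<_ ec eb cb) (s≤s b<c))

cycle-extendGrow : ∀ {σ N} → CycleShape σ N → CycleShape (extend N 1 σ) (suc N)
cycle-extendGrow {σ} {N} C = record
  { cycle-pos = s≤s z≤n
  ; cycle-succ = succ
  ; cycle-last = extend-top N 1 σ (cycle-fixedAbove C (suc N) ≤-refl)
  ; cycle-fixedAbove = fixedAbove-extend 1 (s≤s z≤n) (cycle-fixedAbove C) }
  where
  succ : ∀ i → 1 ≤ i → i < suc N → extend N 1 σ i ≡ suc i
  succ i 1≤i lt with cycle-view C i (≤-pred lt)
  ... | inj₂ refl = ⊥-elim (<-irrefl refl 1≤i)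
  ... | inj₁ (inj₂ (refl , e)) rewrite e = swap-hitʳ (suc N) 1
  ... | inj₁ (inj₁ (lt' , e)) rewrite e =
    swap-miss (suc N) 1 (suc i) (λ q → <-irrefl (cong pred q) lt') (λ q → <-irrefl (sym (cong pred q)) 1≤i)

record TopFixedShape (σ : ℕ → ℕ) (N : ℕ) : Set where
  field
    top-fixed : σ N ≡ N
    top-descent : ∃[ i ] (1 ≤ i × i < N × σ i < N)
    top-bounded : BoundedBy σ N
    top-fixedAbove : FixedAbove σ N
    top-avoids132 : Avoids132 N σ
open TopFixedShape public

topFixed-extend : ∀ {σ N} → 1 ≤ N → BoundedBy σ N → FixedAbove σ N → Avoids132 N σ
  → TopFixedShape (extend N (suc N) σ) (suc N)
topFixed-extend {σ} {N} 1≤N bd fx av = record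
  { top-fixed = extend-top N (suc N) σ (fx (suc N) ≤-refl)
  ; top-descent = N , 1≤N , ≤-refl , subst (_< suc N) (sym (swap-diag (suc N) (σ N))) (s≤s (bd N 1≤N ≤-refl))
  ; top-bounded = boundedBy-extend (suc N) ≤-refl bd fx
  ; top-fixedAbove = fixedAbove-extend (suc N) ≤-refl fx
  ; top-avoids132 = avoids132-extend (suc N) ≤-refl bd fx av
      (λ i j 1≤i i<j j≤N N<σj → ⊥-elim (<-irrefl refl (<-≤-trans N<σj (bd j (≤-trans 1≤i (<⇒≤ i<j)) j≤N))))
      (λ a b c 1≤a a<b b<c c≤N σb≡ _ →
        <-irrefl σb≡ (s≤s (bd b (≤-trans 1≤a (<⇒≤ a<b)) (<⇒≤ (<-≤-trans b<c c≤N))))) }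

topFixed-occurs132 : ∀ {σ N} → TopFixedShape σ N → Occurs132Below (extend N N σ) (suc N) N
topFixed-occurs132 {σ} {N} F with top-descent F
... | i , 1≤i , i<N , σi<N = occurs132Below-new N i N 1≤i i<N ≤-refl (top-fixed F) σi<N ≤-refl (top-fixedAbove F)

-- The two-block shape

<⇒offset : ∀ x i → x < i → Σ ℕ λ t → 1 ≤ t × i ≡ x + t
<⇒offset zero (suc i) _ = suc i , s≤s z≤n , refl
<⇒offset (suc x) (suc i) (s≤s lt) with <⇒offset x i lt
... | t , 1≤t , e = t , 1≤t , cong suc e

record BlockShape (σ : ℕ → ℕ) (N a x y : ℕ) : Set where
  field
    blocks-nonempty : 1 ≤ x + y
    last-value-pos : 1 ≤ a
    block-size : x + y + a ≡ N
    blockX : ∀ i → 1 ≤ i → i ≤ x → σ i ≡ a + y + i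
    blockY : ∀ t → 1 ≤ t → t ≤ y → σ (x + t) ≡ a + t
    tail-low : ∀ i → x + y < i → i ≤ N → σ i ≤ a
    last-value : σ N ≡ a
    descent : ∃[ i ] (1 ≤ i × i < N × σ i < a)
    block-fixedAbove : FixedAbove σ N
    block-avoids132 : Avoids132 N σ
open BlockShape public

data BlockView (σ : ℕ → ℕ) (a x y i : ℕ) : Set where
  inX : i ≤ x → σ i ≡ a + y + i → BlockView σ a x y i
  inY : (t : ℕ) → 1 ≤ t → t ≤ y → i ≡ x + t → σ i ≡ a + t → BlockView σ a x y i
  inTail : x + y < i → σ i ≤ a → BlockView σ a x y i

module _ {σ N a x y} (R : BlockShape σ N a x y) where

  block-view : ∀ i → 1 ≤ i → i ≤ N → BlockView σ a x y i
  block-view i 1≤i i≤N with i ≤? x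
  ... | yes i≤x = inX i≤x (blockX R i 1≤i i≤x)
  ... | no i≰x with i ≤? x + y
  ...   | no i≰x+y = inTail (≰⇒> i≰x+y) (tail-low R i (≰⇒> i≰x+y) i≤N)
  ...   | yes i≤x+y with <⇒offset x i (≰⇒> i≰x)
  ...     | t , 1≤t , refl = inY t 1≤t (+-cancelˡ-≤ x t y i≤x+y) refl (blockY R t 1≤t (+-cancelˡ-≤ x t y i≤x+y))

  block-x+y≤N : x + y ≤ N
  block-x+y≤N = subst (x + y ≤_) (block-size R) (m≤m+n (x + y) a)

  block-a≤N : a ≤ N
  block-a≤N = subst (a ≤_) (block-size R) (m≤n+m a (x + y))

  block-1≤N : 1 ≤ N
  block-1≤N = ≤-trans (last-value-pos R) block-a≤N

  block-a+y+x≡N : a + y + x ≡ N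
  block-a+y+x≡N = trans (rearrange a y x) (block-size R)
    where
    rearrange : ∀ a y x → a + y + x ≡ x + y + a
    rearrange = solve-∀

  block-a+y≤N : a + y ≤ N
  block-a+y≤N = subst (a + y ≤_) block-a+y+x≡N (m≤m+n (a + y) x)

  block-bounded : BoundedBy σ N
  block-bounded i 1≤i i≤N with block-view i 1≤i i≤N
  ... | inX i≤x e rewrite e = subst (a + y + i ≤_) block-a+y+x≡N (+-monoʳ-≤ (a + y) i≤x)
  ... | inY t _ t≤y _ e rewrite e = ≤-trans (+-monoʳ-≤ a t≤y) block-a+y≤N
  ... | inTail _ σi≤a = ≤-trans σi≤a block-a≤N

  blockX-above : ∀ i → 1 ≤ i → i ≤ x → a + y < σ i
  blockX-above i 1≤i i≤x = subst (a + y <_) (sym (blockX R i 1≤i i≤x)) (m<m+n (a + y) 1≤i)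

  block-above : ∀ i → 1 ≤ i → i ≤ x + y → a < σ i
  block-above i 1≤i i≤x+y with block-view i 1≤i (≤-trans i≤x+y block-x+y≤N)
  ... | inX i≤x _ = ≤-<-trans (m≤m+n a y) (blockX-above i 1≤i i≤x)
  ... | inY t 1≤t _ _ e = subst (a <_) (sym e) (m<m+n a 1≤t)
  ... | inTail x+y<i _ = ⊥-elim (<-irrefl refl (<-≤-trans x+y<i i≤x+y))

  block-afterX : ∀ i → x < i → i ≤ N → σ i ≤ a + y
  block-afterX i x<i i≤N with block-view i (≤-trans (s≤s z≤n) x<i) i≤N
  ... | inX i≤x _ = ⊥-elim (<-irrefl refl (<-≤-trans x<i i≤x))
  ... | inY t _ t≤y _ e = subst (_≤ a + y) (sym e) (+-monoʳ-≤ a t≤y)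
  ... | inTail _ σi≤a = ≤-trans σi≤a (m≤m+n a y)

-- A shape with an empty second block is the same as one with an empty first block, so
-- shapes can always be presented with a nonempty second block.
normalize : ℕ → ℕ → ℕ × ℕ
normalize x zero = 0 , x
normalize x (suc y) = x , suc y

BlockShape⁺ : (ℕ → ℕ) → ℕ → ℕ → ℕ → ℕ → Set
BlockShape⁺ σ N a x y = BlockShape σ N a x y × 1 ≤ y

block-normalize : ∀ {σ N a x y} → BlockShape σ N a x y
  → BlockShape⁺ σ N a (proj₁ (normalize x y)) (proj₂ (normalize x y))
block-normalize {y = suc y} R = R , s≤s z≤n
block-normalize {σ} {N} {a} {x} {zero} R = record
  { blocks-nonempty = 1≤x
  ; last-value-pos = last-value-pos R
  ; block-size = trans (cong (_+ a) (sym (+-identityʳ x))) (block-size R)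
  ; blockX = λ i 1≤i i≤0 → ⊥-elim (<-irrefl refl (≤-trans 1≤i i≤0))
  ; blockY = λ i 1≤i i≤x → trans (blockX R i 1≤i i≤x) (cong (_+ i) (+-identityʳ a))
  ; tail-low = λ i lt le → tail-low R i (subst (_< i) (sym (+-identityʳ x)) lt) le
  ; last-value = last-value R
  ; descent = descent R
  ; block-fixedAbove = block-fixedAbove R
  ; block-avoids132 = block-avoids132 R }
  , 1≤x
  where
  1≤x : 1 ≤ x
  1≤x = subst (1 ≤_) (+-identityʳ x) (blocks-nonempty R)

-- The letter a + 1 moves the value of position x + 1 to the top, so that position joins
-- the first block.
block-extendGrow : ∀ {σ N a x y} → BlockShape σ N a x (suc y)
  → BlockShape (extend N (suc a) σ) (suc N) (suc a) (suc x) y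
block-extendGrow {σ} {N} {a} {x} {y} R = record
  { blocks-nonempty = s≤s z≤n
  ; last-value-pos = s≤s z≤n
  ; block-size = trans (size-eq x y a) (cong suc (block-size R))
  ; blockX = X
  ; blockY = Y
  ; tail-low = low
  ; last-value = extend-top N (suc a) σ (block-fixedAbove R (suc N) ≤-refl)
  ; descent = N , block-1≤N R , ≤-refl , subst (_< suc a) (sym σ'N≡a) (n<1+n a)
  ; block-fixedAbove = fixedAbove-extend (suc a) (s≤s (block-a≤N R)) (block-fixedAbove R)
  ; block-avoids132 = avoids132-extend (suc a) (s≤s (block-a≤N R)) (block-bounded R) (block-fixedAbove R) (block-avoids132 R)
                        prefix-above no-new-2 }
  where
  size-eq : ∀ x y a → suc x + y + suc a ≡ suc (x + suc y + a)
  size-eq = solve-∀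
  top-eq : ∀ a y x → suc a + y + suc x ≡ suc (x + suc y + a)
  top-eq = solve-∀
  above : ∀ i → 1 ≤ i → i ≤ x → suc a < σ i
  above i 1≤i i≤x = ≤-<-trans (subst (suc a ≤_) (sym (+-suc a y)) (s≤s (m≤m+n a y))) (blockX-above R i 1≤i i≤x)
  unmoved : ∀ i → 1 ≤ i → i ≤ N → σ i ≢ suc a → extend N (suc a) σ i ≡ σ i
  unmoved i 1≤i i≤N = extend-miss N (suc a) σ i (block-bounded R i 1≤i i≤N)
  σ'N≡a : extend N (suc a) σ N ≡ a
  σ'N≡a = trans (unmoved N (block-1≤N R) ≤-refl (<⇒≢ (subst (_< suc a) (sym (last-value R)) (n<1+n a)))) (last-value R)
  X : ∀ i → 1 ≤ i → i ≤ suc x → extend N (suc a) σ i ≡ suc a + y + i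
  X i 1≤i i≤ with i ≟ suc x
  ... | yes refl = trans (extend-hit N (suc a) σ (suc x) σ-first-of-Y)
                        (sym (trans (top-eq a y x) (cong suc (block-size R))))
    where
    σ-first-of-Y : σ (suc x) ≡ suc a
    σ-first-of-Y = subst₂ (λ p v → σ p ≡ v) (+-comm x 1) (+-comm a 1) (blockY R 1 (s≤s z≤n) (s≤s z≤n))
  ... | no i≢ = trans (unmoved i 1≤i (≤-trans i≤x (≤-trans (m≤m+n x (suc y)) (block-x+y≤N R))) (>⇒≢ (above i 1≤i i≤x)))
                      (trans (blockX R i 1≤i i≤x) (cong (_+ i) (+-suc a y)))
    where
    i≤x = ≤-pred (≤∧≢⇒< i≤ i≢)
  Y : ∀ t → 1 ≤ t → t ≤ y → extend N (suc a) σ (suc x + t) ≡ suc a + t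
  Y t 1≤t t≤y rewrite sym (+-suc x t) =
    trans (unmoved (x + suc t) (≤-trans (s≤s z≤n) (m≤n+m (suc t) x)) pos (>⇒≢ (subst (suc a <_) (sym σ≡) (s≤s (m<m+n a 1≤t)))))
          σ≡
    where
    σ≡ = trans (blockY R (suc t) (s≤s z≤n) (s≤s t≤y)) (+-suc a t)
    pos = ≤-trans (+-monoʳ-≤ x (s≤s t≤y)) (block-x+y≤N R)
  low : ∀ i → suc x + y < i → i ≤ suc N → extend N (suc a) σ i ≤ suc a
  low i lt le with i ≟ suc N
  ... | yes refl = ≤-reflexive (extend-top N (suc a) σ (block-fixedAbove R (suc N) ≤-refl))
  ... | no i≢ = subst (_≤ suc a) (sym (unmoved i (≤-trans (s≤s z≤n) lt) i≤N (<⇒≢ (s≤s σi≤a)))) (m≤n⇒m≤1+n σi≤a)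
    where
    i≤N = ≤-pred (≤∧≢⇒< le i≢)
    σi≤a = tail-low R i (subst (_< i) (sym (+-suc x y)) lt) i≤N
  prefix-above : ∀ i j → 1 ≤ i → i < j → j ≤ N → suc a ≤ σ j → suc a ≤ σ i
  prefix-above i j 1≤i i<j j≤N a<σj with j ≤? x + suc y
  ... | yes j≤ = block-above R i 1≤i (≤-trans (<⇒≤ i<j) j≤)
  ... | no j≰ = ⊥-elim (<-irrefl refl (<-≤-trans a<σj (tail-low R j (≰⇒> j≰) j≤N)))
  b≡x+1 : ∀ b → 1 ≤ b → b ≤ N → σ b ≡ suc a → b ≡ x + 1
  b≡x+1 b 1≤b b≤N e with block-view R b 1≤b b≤N
  ... | inX b≤x _ = ⊥-elim (<-irrefl (sym e) (above b 1≤b b≤x))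
  ... | inY t _ _ refl e' = cong (x +_) (+-cancelˡ-≡ a t 1 (trans (sym e') (trans e (sym (+-comm a 1)))))
  ... | inTail _ σb≤a = ⊥-elim (<-irrefl refl (subst (_≤ a) e σb≤a))
  no-new-2 : ∀ a' b c → 1 ≤ a' → a' < b → b < c → c ≤ N → σ b ≡ suc a → σ a' < σ c → ⊥
  no-new-2 a' b c 1≤a' a'<b b<c c≤N e σa'<σc with b≡x+1 b (≤-trans 1≤a' (<⇒≤ a'<b)) (<⇒≤ (<-≤-trans b<c c≤N)) e
  ... | refl = <-irrefl refl (<-≤-trans σa'<σc (≤-trans σc≤ (<⇒≤ (blockX-above R a' 1≤a' a'≤x))))
    where
    a'≤x = ≤-pred (subst (a' <_) (+-comm x 1) a'<b)
    σc≤ = block-afterX R c (<-trans (m<m+n x (s≤s z≤n)) b<c) c≤N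

-- The letter a + y + 1 sends the value of position 1 to the top; the rest of the first block becomes
-- the new second block and everything else drops into the tail.
block-extendNew : ∀ {σ N a x y} → BlockShape σ N a (suc x) y → 1 ≤ y
  → BlockShape (extend N (suc (a + y)) σ) (suc N) (suc (a + y)) 1 x
block-extendNew {σ} {N} {a} {x} {y} R 1≤y = record
  { blocks-nonempty = s≤s z≤n
  ; last-value-pos = s≤s z≤n
  ; block-size = trans (size-eq x a y) (cong suc (block-size R))
  ; blockX = X
  ; blockY = Y
  ; tail-low = low
  ; last-value = extend-top N k σ (block-fixedAbove R (suc N) ≤-refl)
  ; descent = N , block-1≤N R , ≤-refl , subst (_< k) (sym σ'N≡a) a<k
  ; block-fixedAbove = fixedAbove-extend k (s≤s (block-a+y≤N R)) (block-fixedAbove R)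
  ; block-avoids132 = avoids132-extend k (s≤s (block-a+y≤N R)) (block-bounded R) (block-fixedAbove R) (block-avoids132 R)
                        prefix-above no-new-2 }
  where
  k = suc (a + y)
  size-eq : ∀ x a y → 1 + x + suc (a + y) ≡ suc (suc x + y + a)
  size-eq = solve-∀
  top-eq : ∀ a y x → suc (a + y) + x + 1 ≡ suc (suc x + y + a)
  top-eq = solve-∀
  a<k : a < k
  a<k = s≤s (m≤m+n a y)
  unmoved : ∀ i → 1 ≤ i → i ≤ N → σ i ≢ k → extend N k σ i ≡ σ i
  unmoved i 1≤i i≤N = extend-miss N k σ i (block-bounded R i 1≤i i≤N)
  σ'N≡a : extend N k σ N ≡ a
  σ'N≡a = trans (unmoved N (block-1≤N R) ≤-refl (<⇒≢ (subst (_< k) (sym (last-value R)) a<k))) (last-value R)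
  x≤N : suc x ≤ N
  x≤N = ≤-trans (m≤m+n (suc x) y) (block-x+y≤N R)
  X : ∀ i → 1 ≤ i → i ≤ 1 → extend N k σ i ≡ k + x + i
  X (suc zero) _ _ = trans (extend-hit N k σ 1 σ1≡k) (sym (trans (top-eq a y x) (cong suc (block-size R))))
    where
    σ1≡k : σ 1 ≡ k
    σ1≡k = trans (blockX R 1 (s≤s z≤n) (s≤s z≤n)) (+-comm (a + y) 1)
  X (suc (suc i)) _ (s≤s ())
  Y : ∀ t → 1 ≤ t → t ≤ x → extend N k σ (1 + t) ≡ k + t
  Y t 1≤t t≤x = trans (unmoved (suc t) (s≤s z≤n) (≤-trans (s≤s t≤x) x≤N) (>⇒≢ k<σ)) σ≡
    where
    σ≡ : σ (suc t) ≡ k + t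
    σ≡ = trans (blockX R (suc t) (s≤s z≤n) (s≤s t≤x)) (+-suc (a + y) t)
    k<σ : k < σ (suc t)
    k<σ = subst (k <_) (sym σ≡) (m<m+n k 1≤t)
  low : ∀ i → 1 + x < i → i ≤ suc N → extend N k σ i ≤ k
  low i lt le with i ≟ suc N
  ... | yes refl = ≤-reflexive (extend-top N k σ (block-fixedAbove R (suc N) ≤-refl))
  ... | no i≢ = subst (_≤ k) (sym (unmoved i (≤-trans (s≤s z≤n) lt) i≤N (<⇒≢ (s≤s σi≤)))) (m≤n⇒m≤1+n σi≤)
    where
    i≤N = ≤-pred (≤∧≢⇒< le i≢)
    σi≤ = block-afterX R i lt i≤N
  prefix-above : ∀ i j → 1 ≤ i → i < j → j ≤ N → k ≤ σ j → k ≤ σ i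
  prefix-above i j 1≤i i<j j≤N k≤σj with j ≤? suc x
  ... | yes j≤ = blockX-above R i 1≤i (≤-trans (<⇒≤ i<j) j≤)
  ... | no j≰ = ⊥-elim (<-irrefl refl (<-≤-trans k≤σj (block-afterX R j (≰⇒> j≰) j≤N)))
  no-new-2 : ∀ a' b c → 1 ≤ a' → a' < b → b < c → c ≤ N → σ b ≡ k → σ a' < σ c → ⊥
  no-new-2 a' b c 1≤a' a'<b b<c c≤N σb≡k _ with b ≤? suc x
  ... | no b≰ = <-irrefl refl (subst (_≤ a + y) σb≡k (block-afterX R b (≰⇒> b≰) (<⇒≤ (<-≤-trans b<c c≤N))))
  ... | yes b≤ = <-irrefl (sym σb≡k) (subst₂ _<_ (+-comm (a + y) 1) (sym (blockX R b 1≤b b≤)) (+-monoʳ-< (a + y) 1<b))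
    where
    1<b = ≤-trans (s≤s 1≤a') a'<b
    1≤b = ≤-trans 1≤a' (<⇒≤ a'<b)

cycle-extendNew : ∀ {σ n} → CycleShape σ (suc (suc n))
  → BlockShape (extend (suc (suc n)) 2 σ) (suc (suc (suc n))) 2 1 n
cycle-extendNew {σ} {n} C = record
  { blocks-nonempty = s≤s z≤n
  ; last-value-pos = s≤s z≤n
  ; block-size = +-comm (1 + n) 2
  ; blockX = X
  ; blockY = Y
  ; tail-low = low
  ; last-value = extend-top N 2 σ (cycle-fixedAbove C (suc N) ≤-refl)
  ; descent = N , s≤s z≤n , ≤-refl , subst (_< 2) (sym σ'N≡1) (s≤s (s≤s z≤n))
  ; block-fixedAbove = fixedAbove-extend 2 (s≤s (s≤s z≤n)) (cycle-fixedAbove C)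
  ; block-avoids132 = avoids132-extend 2 (s≤s (s≤s z≤n)) (cycle-bounded C) (cycle-fixedAbove C) (cycle-avoids132 C)
                        prefix-above no-new-2 }
  where
  N = suc (suc n)
  σ'N≡1 : extend N 2 σ N ≡ 1
  σ'N≡1 rewrite cycle-last C = swap-miss (suc N) 2 1 (λ ()) (λ ())
  X : ∀ i → 1 ≤ i → i ≤ 1 → extend N 2 σ i ≡ 2 + n + i
  X (suc zero) _ _ = trans (extend-hit N 2 σ 1 (cycle-succ C 1 (s≤s z≤n) (s≤s (s≤s z≤n)))) (+-comm 1 (2 + n))
  X (suc (suc i)) _ (s≤s ())
  Y : ∀ t → 1 ≤ t → t ≤ n → extend N 2 σ (1 + t) ≡ 2 + t
  Y (suc t) _ t≤n rewrite cycle-succ C (suc (suc t)) (s≤s z≤n) (s≤s (s≤s t≤n)) =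
    swap-miss (suc N) 2 (suc (suc (suc t))) (λ e → <-irrefl e (s≤s (s≤s (s≤s t≤n)))) (λ ())
  low : ∀ i → 1 + n < i → i ≤ suc N → extend N 2 σ i ≤ 2
  low i lt le with i ≟ suc N
  ... | yes refl = ≤-reflexive (extend-top N 2 σ (cycle-fixedAbove C (suc N) ≤-refl))
  ... | no i≢ with ≤-antisym (≤-pred (≤∧≢⇒< le i≢)) lt
  ...   | refl = ≤-trans (≤-reflexive σ'N≡1) (s≤s z≤n)
  prefix-above : ∀ i j → 1 ≤ i → i < j → j ≤ N → 2 ≤ σ j → 2 ≤ σ i
  prefix-above i j 1≤i i<j j≤N _ with cycle-view C i (<⇒≤ (<-≤-trans i<j j≤N))
  ... | inj₂ refl = ⊥-elim (<-irrefl refl 1≤i)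
  ... | inj₁ (inj₂ (refl , _)) = ⊥-elim (<-irrefl refl (<-≤-trans i<j j≤N))
  ... | inj₁ (inj₁ (_ , e)) rewrite e = s≤s 1≤i
  no-new-2 : ∀ a' b c → 1 ≤ a' → a' < b → b < c → c ≤ N → σ b ≡ 2 → σ a' < σ c → ⊥
  no-new-2 a' b c 1≤a' a'<b b<c c≤N σb≡2 _ with cycle-view C b (<⇒≤ (<-≤-trans b<c c≤N))
  ... | inj₂ refl = <-irrefl refl (≤-trans 1≤a' (<⇒≤ a'<b))
  ... | inj₁ (inj₂ (_ , e)) with trans (sym σb≡2) e
  ...   | ()
  no-new-2 a' b c 1≤a' a'<b b<c c≤N σb≡2 _ | inj₁ (inj₁ (_ , e)) with trans (sym e) σb≡2
  ...   | refl = <-irrefl refl (≤-trans (s≤s 1≤a') a'<b)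

length-∷ʳ : ∀ (xs : List ℕ) k → length (xs ∷ʳ k) ≡ suc (length xs)
length-∷ʳ [] k = refl
length-∷ʳ (x ∷ xs) k = cong suc (length-∷ʳ xs k)

∷ʳ-view : ∀ (f : List ℕ) M → length f ≡ suc M → Σ (List ℕ) λ g → Σ ℕ λ k → f ≡ g ∷ʳ k × length g ≡ M
∷ʳ-view (x ∷ []) zero refl = [] , x , refl , refl
∷ʳ-view (x ∷ []) (suc M) ()
∷ʳ-view (x ∷ y ∷ f) zero ()
∷ʳ-view (x ∷ y ∷ f) (suc M) e with ∷ʳ-view (y ∷ f) M (cong pred e)
... | g , k , f≡ , len = x ∷ g , k , cong (x ∷_) f≡ , cong suc len

subexcFrom-∷ʳ⁺ : ∀ i (xs : List ℕ) k → SubexcFrom i xs → 1 ≤ k → k ≤ length xs + i → SubexcFrom i (xs ∷ʳ k)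
subexcFrom-∷ʳ⁺ i [] k _ 1≤k k≤ = (1≤k , k≤) , tt
subexcFrom-∷ʳ⁺ i (x ∷ xs) k (p , s) 1≤k k≤ =
  p , subexcFrom-∷ʳ⁺ (suc i) xs k s 1≤k (subst (k ≤_) (sym (+-suc (length xs) i)) k≤)

subexcFrom-∷ʳ⁻ : ∀ i (xs : List ℕ) k → SubexcFrom i (xs ∷ʳ k) → SubexcFrom i xs × 1 ≤ k × k ≤ length xs + i
subexcFrom-∷ʳ⁻ i [] k ((1≤k , k≤) , _) = tt , 1≤k , k≤
subexcFrom-∷ʳ⁻ i (x ∷ xs) k (p , s) with subexcFrom-∷ʳ⁻ (suc i) xs k s
... | s' , 1≤k , k≤ = (p , s') , 1≤k , subst (k ≤_) (+-suc (length xs) i) k≤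

linked-∷ʳ⁺ : ∀ (g : List ℕ) L k → Linked _≤_ (g ∷ʳ L) → L ≤ k → Linked _≤_ (g ∷ʳ L ∷ʳ k)
linked-∷ʳ⁺ [] L k _ L≤k = L≤k ∷ [-]
linked-∷ʳ⁺ (x ∷ []) L k (r ∷ [-]) L≤k = r ∷ L≤k ∷ [-]
linked-∷ʳ⁺ (x ∷ y ∷ g) L k (r ∷ rs) L≤k = r ∷ linked-∷ʳ⁺ (y ∷ g) L k rs L≤k

linked-∷ʳ⁻ : ∀ (g : List ℕ) k → Linked _≤_ (g ∷ʳ k) → Linked _≤_ g
linked-∷ʳ⁻ [] k _ = []
linked-∷ʳ⁻ (x ∷ []) k _ = [-]
linked-∷ʳ⁻ (x ∷ y ∷ g) k (r ∷ rs) = r ∷ linked-∷ʳ⁻ (y ∷ g) k rs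

linked-last : ∀ (g : List ℕ) L k → Linked _≤_ (g ∷ʳ L ∷ʳ k) → L ≤ k
linked-last [] L k (r ∷ _) = r
linked-last (x ∷ []) L k (_ ∷ r ∷ _) = r
linked-last (x ∷ y ∷ g) L k (_ ∷ rs) = linked-last (y ∷ g) L k rs

replicate-∷ʳ : ∀ N → replicate N 1 ∷ʳ 1 ≡ replicate (suc N) 1
replicate-∷ʳ zero = refl
replicate-∷ʳ (suc N) = cong (1 ∷_) (replicate-∷ʳ N)

nonDec-length : ∀ {N f} → NonDecSubexceedant N f → length f ≡ N
nonDec-length ((len , _) , _) = len

nonDec-∷ʳ⁺ : ∀ {N} g L k → NonDecSubexceedant N (g ∷ʳ L) → L ≤ k → 1 ≤ k → k ≤ suc N
  → NonDecSubexceedant (suc N) (g ∷ʳ L ∷ʳ k)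
nonDec-∷ʳ⁺ {N} g L k ((len , sub) , lnk) L≤k 1≤k k≤ =
  (trans (length-∷ʳ f k) (cong suc len) ,
   subexcFrom-∷ʳ⁺ 1 f k sub 1≤k (subst (k ≤_) (trans (+-comm 1 N) (cong (_+ 1) (sym len))) k≤)) ,
  linked-∷ʳ⁺ g L k lnk L≤k
  where f = g ∷ʳ L

nonDec-∷ʳ⁻ : ∀ {N} g k → NonDecSubexceedant (suc N) (g ∷ʳ k) → NonDecSubexceedant N g × 1 ≤ k × k ≤ suc N
nonDec-∷ʳ⁻ {N} g k ((len , sub) , lnk) with subexcFrom-∷ʳ⁻ 1 g k sub
... | sub' , 1≤k , k≤ = ((len' , sub') , linked-∷ʳ⁻ g k lnk) , 1≤k , subst (k ≤_) (trans (cong (_+ 1) len') (+-comm N 1)) k≤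
  where len' = cong pred (trans (sym (length-∷ʳ g k)) len)

boundedBy-resp-≗ : ∀ {σ τ N} → σ ≗ τ → BoundedBy σ N → BoundedBy τ N
boundedBy-resp-≗ e bd i 1≤i i≤N = subst (_≤ _) (e i) (bd i 1≤i i≤N)

fixedAbove-resp-≗ : ∀ {σ τ N} → σ ≗ τ → FixedAbove σ N → FixedAbove τ N
fixedAbove-resp-≗ e fx j N<j = trans (sym (e j)) (fx j N<j)

avoids132-resp-≗ : ∀ {σ τ N} → σ ≗ τ → Avoids132 N σ → Avoids132 N τ
avoids132-resp-≗ e av (a , b , c , h₁ , h₂ , h₃ , h₄ , ac , cb) =
  av (a , b , c , h₁ , h₂ , h₃ , h₄ , subst₂ _<_ (sym (e a)) (sym (e c)) ac , subst₂ _<_ (sym (e c)) (sym (e b)) cb)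

occurs132Below-resp-≗ : ∀ {σ τ N L} → σ ≗ τ → Occurs132Below σ N L → Occurs132Below τ N L
occurs132Below-resp-≗ e (a , b , c , h₁ , h₂ , h₃ , h₄ , ac , cb , aL) =
  a , b , c , h₁ , h₂ , h₃ , h₄ , subst₂ _<_ (e a) (e c) ac , subst₂ _<_ (e c) (e b) cb , subst (_< _) (e a) aL

cycle-resp-≗ : ∀ {σ τ N} → σ ≗ τ → CycleShape σ N → CycleShape τ N
cycle-resp-≗ e C = record
  { cycle-pos = cycle-pos C
  ; cycle-succ = λ i 1≤i i<N → trans (sym (e i)) (cycle-succ C i 1≤i i<N)
  ; cycle-last = trans (sym (e _)) (cycle-last C)
  ; cycle-fixedAbove = fixedAbove-resp-≗ e (cycle-fixedAbove C) }

topFixed-resp-≗ : ∀ {σ τ N} → σ ≗ τ → TopFixedShape σ N → TopFixedShape τ N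
topFixed-resp-≗ e F = record
  { top-fixed = trans (sym (e _)) (top-fixed F)
  ; top-descent = let (i , 1≤i , i<N , σi<N) = top-descent F in i , 1≤i , i<N , subst (_< _) (e i) σi<N
  ; top-bounded = boundedBy-resp-≗ e (top-bounded F)
  ; top-fixedAbove = fixedAbove-resp-≗ e (top-fixedAbove F)
  ; top-avoids132 = avoids132-resp-≗ e (top-avoids132 F) }

block-resp-≗ : ∀ {σ τ N a x y} → σ ≗ τ → BlockShape σ N a x y → BlockShape τ N a x y
block-resp-≗ e R = record
  { blocks-nonempty = blocks-nonempty R
  ; last-value-pos = last-value-pos R
  ; block-size = block-size R
  ; blockX = λ i 1≤i i≤x → trans (sym (e i)) (blockX R i 1≤i i≤x)
  ; blockY = λ t 1≤t t≤y → trans (sym (e _)) (blockY R t 1≤t t≤y)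
  ; tail-low = λ i lt i≤N → subst (_≤ _) (e i) (tail-low R i lt i≤N)
  ; last-value = trans (sym (e _)) (last-value R)
  ; descent = let (i , 1≤i , i<N , σi<a) = descent R in i , 1≤i , i<N , subst (_< _) (e i) σi<a
  ; block-fixedAbove = fixedAbove-resp-≗ e (block-fixedAbove R)
  ; block-avoids132 = avoids132-resp-≗ e (block-avoids132 R) }

-- Encoding partitions

data State : Set where
  cyc : ℕ → State
  blk : ℕ → ℕ → ℕ → ℕ → State

mkBlock : ℕ → ℕ → ℕ × ℕ → State
mkBlock N a (x , y) = blk N a x y

size : State → ℕ
size (cyc N) = N
size (blk N _ _ _) = N

lastLetter : State → ℕ
lastLetter (cyc _) = 1
lastLetter (blk _ a _ _) = a

growLetter : State → ℕ
growLetter (cyc _) = 1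
growLetter (blk _ a _ _) = suc a

growState : State → State
growState (cyc N) = cyc (suc N)
growState (blk N a x zero) = blk N a x zero
growState (blk N a x (suc y)) = mkBlock (suc N) (suc a) (normalize (suc x) y)

newLetter : State → ℕ
newLetter (cyc (suc zero)) = 1
newLetter (cyc _) = 2
newLetter (blk _ a zero _) = suc a
newLetter (blk _ a (suc _) y) = suc (a + y)

newState : State → State
newState (cyc zero) = cyc zero
newState (cyc (suc zero)) = cyc 2
newState (cyc (suc (suc n))) = mkBlock (suc (suc (suc n))) 2 (normalize 1 n)
newState (blk N a zero zero) = blk N a zero zero
newState (blk N a zero (suc y)) = mkBlock (suc N) (suc a) (normalize 1 y)
newState (blk N a (suc x) y) = mkBlock (suc N) (suc (a + y)) (normalize 1 x)

Config : Set
Config = List ℕ × State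

newPart growPart : Config → Config
newPart (f , s) = f ∷ʳ newLetter s , newState s
growPart (f , s) = f ∷ʳ growLetter s , growState s

growPartⁿ : ℕ → Config → Config
growPartⁿ zero e = e
growPartⁿ (suc r) e = growPart (growPartⁿ r e)

-- Partitions are taken as ascending lists and built from the back, i.e. from the largest
-- part down.
encode : List ℕ → Config
encode [] = 1 ∷ [] , cyc 1
encode (zero ∷ ρ) = encode ρ
encode (suc r ∷ ρ) = growPartⁿ r (newPart (encode ρ))

Ascending : List ℕ → Set
Ascending ρ = All (1 ≤_) ρ × Linked _≤_ ρ

-- In a block state the part under construction is x and the previous part is x + y; the
-- normalized form with x = 0 records that the current part has reached the previous one.
Tracks : State → List ℕ → Set
Tracks (cyc N) ρ = (N ≡ 1 × ρ ≡ []) ⊎ (Σ ℕ λ r → N ≡ suc (suc r) × ρ ≡ suc r ∷ [])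
Tracks (blk N a zero y) ρ = Σ (List ℕ) λ rest → ρ ≡ y ∷ y ∷ rest
Tracks (blk N a (suc x) y) ρ = Σ (List ℕ) λ rest → ρ ≡ suc x ∷ (suc x + y) ∷ rest

ShapeOf : List ℕ → State → Set
ShapeOf f (cyc N) = CycleShape (φ f) N × f ≡ replicate N 1
ShapeOf f (blk N a x y) = BlockShape⁺ (φ f) N a x y

record Invariant (e : Config) (ρ : List ℕ) : Set where
  constructor invariant
  field
    inv-code : NonDecSubexceedant (size (proj₂ e)) (proj₁ e)
    inv-shape : ShapeOf (proj₁ e) (proj₂ e)
    inv-tracks : Tracks (proj₂ e) ρ
    inv-size : size (proj₂ e) ≡ suc (sum ρ)
    inv-last : Σ (List ℕ) λ g → proj₁ e ≡ g ∷ʳ lastLetter (proj₂ e)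
open Invariant public

invariant-[] : Invariant (encode []) []
invariant-[] = invariant ((refl , (s≤s z≤n , s≤s z≤n) , tt) , [-]) (C , refl) (inj₁ (refl , refl)) refl ([] , refl)
  where
  C : CycleShape (φ (1 ∷ [])) 1
  C = record
    { cycle-pos = s≤s z≤n
    ; cycle-succ = λ i 1≤i i<1 → ⊥-elim (<-irrefl refl (≤-trans (s≤s 1≤i) i<1))
    ; cycle-last = refl
    ; cycle-fixedAbove = λ j _ → swap-diag 1 j }

invariant-newPart : ∀ {f s ρ} → Invariant (f , s) ρ → Invariant (newPart (f , s)) (1 ∷ ρ)
invariant-newPart {f} {cyc zero} (invariant _ _ (inj₁ (() , _)) _ _)
invariant-newPart {f} {cyc zero} (invariant _ _ (inj₂ (_ , () , _)) _ _)
invariant-newPart {f} {cyc (suc zero)} (invariant code (C , f≡) (inj₁ (refl , refl)) _ (g , refl)) =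
  invariant (nonDec-∷ʳ⁺ g 1 1 code ≤-refl ≤-refl (s≤s z≤n))
    (cycle-resp-≗ (extend-φ f 1 1 (nonDec-length code)) (cycle-extendGrow C) , trans (cong (_∷ʳ 1) f≡) (replicate-∷ʳ 1))
    (inj₂ (0 , refl , refl)) refl (f , refl)
invariant-newPart {f} {cyc (suc zero)} (invariant _ _ (inj₂ (_ , () , _)) _ _)
invariant-newPart {f} {cyc (suc (suc n))} (invariant _ _ (inj₁ (() , _)) _ _)
invariant-newPart {f} {cyc (suc (suc n))} (invariant code (C , _) (inj₂ (r , refl , refl)) _ (g , refl)) =
  invariant (nonDec-∷ʳ⁺ g 1 2 code (s≤s z≤n) (s≤s z≤n) (s≤s (s≤s z≤n)))
    (block-normalize (block-resp-≗ (extend-φ f 2 _ (nonDec-length code)) (cycle-extendNew C)))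
    (tracks r) (cong (λ z → suc (suc (suc z))) (sym (+-identityʳ r))) (f , refl)
  where
  tracks : ∀ r → Tracks (mkBlock (suc (suc (suc r))) 2 (normalize 1 r)) (1 ∷ suc r ∷ [])
  tracks zero = [] , refl
  tracks (suc r) = [] , refl
invariant-newPart {f} {blk N a zero zero} (invariant _ (_ , ()) _ _ _)
invariant-newPart {f} {blk N a zero (suc y)} (invariant code (R , _) (rest , refl) size≡ (g , refl)) =
  invariant (nonDec-∷ʳ⁺ g a (suc a) code (n≤1+n a) (s≤s z≤n) (s≤s (block-a≤N R)))
    (block-normalize (block-resp-≗ (extend-φ f (suc a) N (nonDec-length code)) (block-extendGrow R)))
    (tracks y) (cong suc size≡) (f , refl)
  where
  tracks : ∀ y → Tracks (mkBlock (suc N) (suc a) (normalize 1 y)) (1 ∷ suc y ∷ suc y ∷ rest)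
  tracks zero = 1 ∷ rest , refl
  tracks (suc y) = suc (suc y) ∷ rest , refl
invariant-newPart {f} {blk N a (suc x) y} (invariant code (R , 1≤y) (rest , refl) size≡ (g , refl)) =
  invariant (nonDec-∷ʳ⁺ g a (suc (a + y)) code (m≤n⇒m≤1+n (m≤m+n a y)) (s≤s z≤n) (s≤s (block-a+y≤N R)))
    (block-normalize (block-resp-≗ (extend-φ f (suc (a + y)) N (nonDec-length code)) (block-extendNew R 1≤y)))
    (tracks x) (cong suc size≡) (f , refl)
  where
  tracks : ∀ x → Tracks (mkBlock (suc N) (suc (a + y)) (normalize 1 x)) (1 ∷ suc x ∷ (suc x + y) ∷ rest)
  tracks zero = suc y ∷ rest , refl
  tracks (suc x) = suc (suc x) + y ∷ rest , refl

invariant-growPart : ∀ {f s r ρ} → Invariant (f , s) (suc r ∷ ρ) → Linked _≤_ (suc (suc r) ∷ ρ)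
  → Invariant (growPart (f , s)) (suc (suc r) ∷ ρ)
invariant-growPart {f} {cyc N} (invariant _ _ (inj₁ (_ , ())) _ _) _
invariant-growPart {f} {cyc N} (invariant code (C , f≡) (inj₂ (r , refl , refl)) _ (g , refl)) _ =
  invariant (nonDec-∷ʳ⁺ g 1 1 code ≤-refl ≤-refl (s≤s z≤n))
    (cycle-resp-≗ (extend-φ f 1 _ (nonDec-length code)) (cycle-extendGrow C) , trans (cong (_∷ʳ 1) f≡) (replicate-∷ʳ _))
    (inj₂ (suc r , refl , refl)) (cong (λ z → suc (suc (suc z))) (sym (+-identityʳ r))) (f , refl)
invariant-growPart {f} {blk N a zero y} (invariant _ _ (rest , refl) _ _) (y<y ∷ _) = ⊥-elim (<-irrefl refl y<y)
invariant-growPart {f} {blk N a (suc x) zero} (invariant _ (_ , ()) _ _ _) _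
invariant-growPart {f} {blk N a (suc x) (suc y)} (invariant code (R , _) (rest , refl) size≡ (g , refl)) _ =
  invariant (nonDec-∷ʳ⁺ g a (suc a) code (n≤1+n a) (s≤s z≤n) (s≤s (block-a≤N R)))
    (block-normalize (block-resp-≗ (extend-φ f (suc a) N (nonDec-length code)) (block-extendGrow R)))
    (tracks y) (cong suc size≡) (f , refl)
  where
  tracks : ∀ y → Tracks (mkBlock (suc N) (suc a) (normalize (suc (suc x)) y)) (suc (suc x) ∷ suc x + suc y ∷ rest)
  tracks zero = rest , cong (λ z → suc (suc x) ∷ z ∷ rest) (trans (+-suc (suc x) 0) (cong (λ z → suc (suc z)) (+-identityʳ x)))
  tracks (suc y) = rest , cong (λ z → suc (suc x) ∷ z ∷ rest) (+-suc (suc x) (suc y))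

invariant-∷ : ∀ r ρ → Linked _≤_ (suc r ∷ ρ) → Invariant (encode ρ) ρ
  → Invariant (encode (suc r ∷ ρ)) (suc r ∷ ρ)
invariant-∷ zero ρ _ I = invariant-newPart I
invariant-∷ (suc r) [] _ I = invariant-growPart (invariant-∷ r [] [-] I) [-]
invariant-∷ (suc r) (q ∷ ρ) (r<q ∷ lnk) I =
  invariant-growPart (invariant-∷ r (q ∷ ρ) (≤-trans (n≤1+n _) r<q ∷ lnk) I) (r<q ∷ lnk)

encode-invariant : ∀ ρ → Ascending ρ → Invariant (encode ρ) ρ
encode-invariant [] _ = invariant-[]
encode-invariant (zero ∷ ρ) (() ∷ _ , _)
encode-invariant (suc r ∷ ρ) (_ ∷ pos , lnk) = invariant-∷ r ρ lnk (encode-invariant ρ (pos , Linked.tail lnk))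

-- In the third case L is the last letter, so by monotonicity all later letters are ≥ L
-- and the occurrence survives every extension.
data Classified (N : ℕ) (f : List ℕ) : Set where
  encoded : (ρ : List ℕ) → Ascending ρ → proj₁ (encode ρ) ≡ f → Classified N f
  topFixed : TopFixedShape (φ f) N → Σ (List ℕ) (λ g → f ≡ g ∷ʳ N) → Classified N f
  occurs132 : (L : ℕ) → Occurs132Below (φ f) N L → BoundedBy (φ f) N → FixedAbove (φ f) N
    → Σ (List ℕ) (λ g → f ≡ g ∷ʳ L) → Classified N f

classify-occurs132 : ∀ {N} g k → length g ≡ N → k ≤ suc N → BoundedBy (φ g) N → FixedAbove (φ g) N
  → Occurs132Below (extend N k (φ g)) (suc N) k → Classified (suc N) (g ∷ʳ k)
classify-occurs132 g k len k≤ bd fx occ =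
  occurs132 k (occurs132Below-resp-≗ e occ) (boundedBy-resp-≗ e (boundedBy-extend k k≤ bd fx))
    (fixedAbove-resp-≗ e (fixedAbove-extend k k≤ fx)) (g , refl)
  where e = extend-φ g k _ len

classify-topFixed : ∀ {N} g → length g ≡ N → 1 ≤ N → BoundedBy (φ g) N → FixedAbove (φ g) N
  → Avoids132 N (φ g) → Classified (suc N) (g ∷ʳ suc N)
classify-topFixed g len 1≤N bd fx av =
  topFixed (topFixed-resp-≗ (extend-φ g _ _ len) (topFixed-extend 1≤N bd fx av)) (g , refl)

blockY-occurs132 : ∀ {σ N a x y} → BlockShape σ N a x y → ∀ t → 2 ≤ t → t ≤ y
  → Occurs132Below (extend N (a + t) σ) (suc N) (a + t)
blockY-occurs132 R (suc zero) (s≤s ()) _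
blockY-occurs132 {σ} {N} {a} {x} {y} R (suc (suc t)) _ t≤y =
  occurs132Below-new (a + suc (suc t)) (x + suc t) (x + suc (suc t)) (≤-trans (s≤s z≤n) (m≤n+m (suc t) x))
    (+-monoʳ-< x ≤-refl) (≤-trans (+-monoʳ-≤ x t≤y) (block-x+y≤N R)) (blockY R (suc (suc t)) (s≤s z≤n) t≤y)
    (subst (_< a + suc (suc t)) (sym (blockY R (suc t) (s≤s z≤n) (≤-trans (n≤1+n _) t≤y))) (+-monoʳ-< a ≤-refl))
    (≤-trans (+-monoʳ-≤ a t≤y) (block-a+y≤N R)) (block-fixedAbove R)

blockX-occurs132 : ∀ {σ N a x y} → BlockShape σ N a x y → ∀ u → 2 ≤ u → u ≤ x
  → Occurs132Below (extend N (a + (y + u)) σ) (suc N) (a + (y + u))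
blockX-occurs132 R (suc zero) (s≤s ()) _
blockX-occurs132 {σ} {N} {a} {x} {y} R (suc (suc u)) _ u≤x rewrite sym (+-assoc a y (suc (suc u))) =
  occurs132Below-new (a + y + suc (suc u)) (suc u) (suc (suc u)) (s≤s z≤n) ≤-refl
    (≤-trans u≤x (≤-trans (m≤m+n x y) (block-x+y≤N R))) (blockX R (suc (suc u)) (s≤s z≤n) u≤x)
    (subst (_< a + y + suc (suc u)) (sym (blockX R (suc u) (s≤s z≤n) (≤-trans (n≤1+n _) u≤x))) (+-monoʳ-< (a + y) ≤-refl))
    (subst (a + y + suc (suc u) ≤_) (block-a+y+x≡N R) (+-monoʳ-≤ (a + y) u≤x)) (block-fixedAbove R)

lastValue-occurs132 : ∀ {σ N a x y} → BlockShape σ N a x y → Occurs132Below (extend N a σ) (suc N) a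
lastValue-occurs132 R with descent R
... | i , 1≤i , i<N , σi<a = occurs132Below-new _ i _ 1≤i i<N ≤-refl (last-value R) σi<a (block-a≤N R) (block-fixedAbove R)

cycle-occurs132 : ∀ {σ N} → CycleShape σ N → ∀ j → 3 + j ≤ N → Occurs132Below (extend N (3 + j) σ) (suc N) (3 + j)
cycle-occurs132 C j 3+j≤N =
  occurs132Below-new _ (suc j) (suc (suc j)) (s≤s z≤n) ≤-refl (≤-trans (n≤1+n _) 3+j≤N)
    (cycle-succ C (suc (suc j)) (s≤s z≤n) 3+j≤N)
    (subst (_< 3 + j) (sym (cycle-succ C (suc j) (s≤s z≤n) (≤-trans (n≤1+n _) 3+j≤N))) ≤-refl)
    3+j≤N (cycle-fixedAbove C)

encode-newPart : ∀ ρ f s → encode ρ ≡ (f , s) → ∀ k → newLetter s ≡ k → proj₁ (encode (1 ∷ ρ)) ≡ f ∷ʳ k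
encode-newPart ρ f s e k k≡ = cong₂ _∷ʳ_ (cong proj₁ e) (trans (cong (newLetter ∘ proj₂) e) k≡)

encode-growPart : ∀ r ρ f s → encode (suc r ∷ ρ) ≡ (f , s) → ∀ k → growLetter s ≡ k
  → proj₁ (encode (suc (suc r) ∷ ρ)) ≡ f ∷ʳ k
encode-growPart r ρ f s e k k≡ = cong₂ _∷ʳ_ (cong proj₁ e) (trans (cong (growLetter ∘ proj₂) e) k≡)

classify-cycle : ∀ N ρ f k → encode ρ ≡ (f , cyc N) → CycleShape (φ f) N → Tracks (cyc N) ρ → length f ≡ N
  → 1 ≤ k → k ≤ suc N → Classified (suc N) (f ∷ʳ k)
classify-cycle N ρ f k e C tracks len 1≤k k≤ with k ≟ suc N
... | yes refl = classify-topFixed f len (cycle-pos C) (cycle-bounded C) (cycle-fixedAbove C) (cycle-avoids132 C)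
classify-cycle .1 .[] f (suc zero) e C (inj₁ (refl , refl)) len _ _ | no _ =
  encoded (1 ∷ []) (s≤s z≤n ∷ [] , [-]) (encode-newPart [] f (cyc 1) e 1 refl)
classify-cycle .1 .[] f (suc (suc k)) e C (inj₁ (refl , refl)) len _ (s≤s (s≤s z≤n)) | no k≢ = ⊥-elim (k≢ refl)
classify-cycle .(2 + r) .(suc r ∷ []) f (suc zero) e C (inj₂ (r , refl , refl)) len _ _ | no _ =
  encoded (suc (suc r) ∷ []) (s≤s z≤n ∷ [] , [-]) (encode-growPart r [] f (cyc _) e 1 refl)
classify-cycle .(2 + r) .(suc r ∷ []) f (suc (suc zero)) e C (inj₂ (r , refl , refl)) len _ _ | no _ =
  encoded (1 ∷ suc r ∷ []) (s≤s z≤n ∷ s≤s z≤n ∷ [] , s≤s z≤n ∷ [-]) (encode-newPart (suc r ∷ []) f _ e 2 refl)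
classify-cycle .(2 + r) .(suc r ∷ []) f (suc (suc (suc j))) e C (inj₂ (r , refl , refl)) len _ k≤ | no k≢ =
  classify-occurs132 f _ len k≤ (cycle-bounded C) (cycle-fixedAbove C) (cycle-occurs132 C j (≤-pred (≤∧≢⇒< k≤ k≢)))

-- Letters a + t with 1 ≤ t ≤ y hit the second block: t = 1 extends the current part.
classify-blockY : ∀ N a x y ρ f t → Ascending ρ → encode ρ ≡ (f , blk N a x y) → BlockShape (φ f) N a x y
  → 1 ≤ y → Tracks (blk N a x y) ρ → length f ≡ N → 1 ≤ t → t ≤ y → Classified (suc N) (f ∷ʳ (a + t))
classify-blockY N a zero y ρ f (suc zero) (pos , lnk) e R 1≤y (rest , refl) len _ _ =
  encoded (1 ∷ ρ) (s≤s z≤n ∷ pos , 1≤y ∷ lnk) (encode-newPart ρ f _ e (a + 1) (+-comm 1 a))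
classify-blockY N a (suc x) y ρ f (suc zero) (_ ∷ pos , _ ∷ lnk) e R 1≤y (rest , refl) len _ _ =
  encoded (suc (suc x) ∷ suc x + y ∷ rest)
    (s≤s z≤n ∷ pos , s≤s (subst (_≤ x + y) (+-comm x 1) (+-monoʳ-≤ x 1≤y)) ∷ lnk)
    (encode-growPart x (suc x + y ∷ rest) f _ e (a + 1) (+-comm 1 a))
classify-blockY N a x y ρ f (suc (suc t)) _ e R _ _ len _ t≤y =
  classify-occurs132 f _ len (m≤n⇒m≤1+n (≤-trans (+-monoʳ-≤ a t≤y) (block-a+y≤N R))) (block-bounded R) (block-fixedAbove R)
    (blockY-occurs132 R (suc (suc t)) (s≤s (s≤s z≤n)) t≤y)

-- Letters a + y + u with 1 ≤ u ≤ x hit the first block: u = 1 starts a new part.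
classify-blockX : ∀ N a x y ρ f u → Ascending ρ → encode ρ ≡ (f , blk N a x y) → BlockShape (φ f) N a x y
  → Tracks (blk N a x y) ρ → length f ≡ N → 1 ≤ u → u ≤ x → Classified (suc N) (f ∷ʳ (a + (y + u)))
classify-blockX N a (suc x) y ρ f (suc zero) (pos , lnk) e R (rest , refl) len _ _ =
  encoded (1 ∷ ρ) (s≤s z≤n ∷ pos , s≤s z≤n ∷ lnk)
    (encode-newPart ρ f _ e (a + (y + 1)) (trans (sym (+-comm (a + y) 1)) (+-assoc a y 1)))
classify-blockX N a x y ρ f (suc (suc u)) _ e R _ len _ u≤x =
  classify-occurs132 f _ len (m≤n⇒m≤1+n (subst (_≤ N) (+-assoc a y (suc (suc u))) letter≤N))
    (block-bounded R) (block-fixedAbove R) (blockX-occurs132 R (suc (suc u)) (s≤s (s≤s z≤n)) u≤x)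
  where
  letter≤N : a + y + suc (suc u) ≤ N
  letter≤N = subst (a + y + suc (suc u) ≤_) (block-a+y+x≡N R) (+-monoʳ-≤ (a + y) u≤x)

classify-block : ∀ N a x y ρ f k → Ascending ρ → encode ρ ≡ (f , blk N a x y) → BlockShape (φ f) N a x y → 1 ≤ y
  → Tracks (blk N a x y) ρ → length f ≡ N → a ≤ k → k ≤ suc N → Classified (suc N) (f ∷ʳ k)
classify-block N a x y ρ f k asc e R 1≤y tracks len a≤k k≤ with k ≟ a | k ≟ suc N
... | yes refl | _ = classify-occurs132 f _ len k≤ (block-bounded R) (block-fixedAbove R) (lastValue-occurs132 R)
... | no _ | yes refl = classify-topFixed f len (block-1≤N R) (block-bounded R) (block-fixedAbove R) (block-avoids132 R)
... | no k≢a | no k≢ with <⇒offset a k (≤∧≢⇒< a≤k (k≢a ∘ sym))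
...   | t , 1≤t , refl with t ≤? y
...     | yes t≤y = classify-blockY N a x y ρ f t asc e R 1≤y tracks len 1≤t t≤y
...     | no t≰y with <⇒offset y t (≰⇒> t≰y)
...       | u , 1≤u , refl = classify-blockX N a x y ρ f u asc e R tracks len 1≤u u≤x
  where
  a+t≤N : a + (y + u) ≤ N
  a+t≤N = ≤-pred (≤∧≢⇒< k≤ k≢)
  u≤x : u ≤ x
  u≤x = +-cancelˡ-≤ y u x (+-cancelˡ-≤ a (y + u) (y + x) (subst (a + (y + u) ≤_) N≡ a+t≤N))
    where
    N≡ : N ≡ a + (y + x)
    N≡ = trans (sym (block-a+y+x≡N R)) (+-assoc a y x)

classify-encoded : ∀ {N k} ρ f s → encode ρ ≡ (f , s) → Invariant (f , s) ρ → Ascending ρ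
  → NonDecSubexceedant N f → NonDecSubexceedant (suc N) (f ∷ʳ k) → Classified (suc N) (f ∷ʳ k)
classify-encoded {N} {k} ρ f (cyc _) e (invariant code (C , _) tracks _ _) asc codeN code'
  with trans (sym (nonDec-length code)) (nonDec-length codeN) | nonDec-∷ʳ⁻ f k code'
... | refl | _ , 1≤k , k≤ = classify-cycle N ρ f k e C tracks (nonDec-length codeN) 1≤k k≤
classify-encoded {N} {k} ρ f (blk _ a x y) e (invariant code (R , 1≤y) tracks _ (g , refl)) asc codeN code'
  with trans (sym (nonDec-length code)) (nonDec-length codeN) | nonDec-∷ʳ⁻ f k code'
... | refl | _ , _ , k≤ =
  classify-block N a x y ρ f k asc e R 1≤y tracks (nonDec-length codeN) (linked-last g a k (proj₂ code')) k≤

classify-∷ʳ : ∀ {N g k} → 1 ≤ N → NonDecSubexceedant N g → Classified N g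
  → NonDecSubexceedant (suc N) (g ∷ʳ k) → Classified (suc N) (g ∷ʳ k)
classify-∷ʳ 1≤N code (encoded ρ asc refl) code' =
  classify-encoded ρ _ _ refl (encode-invariant ρ asc) asc code code'
classify-∷ʳ {N} {g} {k} 1≤N code (topFixed F (g' , refl)) code' with nonDec-∷ʳ⁻ g k code' | k ≟ suc N
... | _ , _ , k≤ | yes refl = classify-topFixed g (nonDec-length code) 1≤N (top-bounded F) (top-fixedAbove F) (top-avoids132 F)
... | _ , _ , k≤ | no k≢ with ≤-antisym (linked-last g' N k (proj₂ code')) (≤-pred (≤∧≢⇒< k≤ k≢))
...   | refl = classify-occurs132 g N (nonDec-length code) (n≤1+n N) (top-bounded F) (top-fixedAbove F) (topFixed-occurs132 F)
classify-∷ʳ {N} {g} {k} 1≤N code (occurs132 L occ bd fx (g' , refl)) code' with nonDec-∷ʳ⁻ g k code'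
... | _ , _ , k≤ =
  classify-occurs132 g k (nonDec-length code) k≤ bd fx (occurs132Below-extend k (linked-last g' L k (proj₂ code')) k≤ bd fx occ)

classify : ∀ M f → NonDecSubexceedant (suc M) f → Classified (suc M) f
classify zero (suc zero ∷ []) _ = encoded [] ([] , []) refl
classify zero (zero ∷ []) ((_ , (() , _) , _) , _)
classify zero (suc (suc x) ∷ []) ((_ , (_ , s≤s ()) , _) , _)
classify (suc M) f code with ∷ʳ-view f (suc M) (nonDec-length code)
... | g , k , refl , _ = classify-∷ʳ (s≤s z≤n) codeg (classify M g codeg) code
  where codeg = proj₁ (nonDec-∷ʳ⁻ g k code)

-- Decoding

incHead : List ℕ → List ℕ
incHead [] = []
incHead (r ∷ ρ) = suc r ∷ ρ

decodeStep : State × List ℕ → ℕ → State × List ℕ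
decodeStep (cyc zero , ρ) k = cyc zero , ρ
decodeStep (cyc (suc zero) , ρ) k = cyc 2 , 1 ∷ ρ
decodeStep (s@(cyc (suc (suc n))) , ρ) k = if k ≡ᵇ 1 then (growState s , incHead ρ) else (newState s , 1 ∷ ρ)
decodeStep (s@(blk N a zero y) , ρ) k = newState s , 1 ∷ ρ
decodeStep (s@(blk N a (suc x) y) , ρ) k = if k ≡ᵇ suc a then (growState s , incHead ρ) else (newState s , 1 ∷ ρ)

decode : List ℕ → State × List ℕ
decode [] = cyc 1 , []
decode (_ ∷ rest) = foldl decodeStep (cyc 1 , []) rest

decode-∷ʳ : ∀ g L k → decode (g ∷ʳ L ∷ʳ k) ≡ decodeStep (decode (g ∷ʳ L)) k
decode-∷ʳ [] L k = refl
decode-∷ʳ (x ∷ g) L k = foldl-∷ʳ decodeStep (cyc 1 , []) k (g ∷ʳ L)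

decodeStep-newPart : ∀ {f s ρ} → Invariant (f , s) ρ → decodeStep (s , ρ) (newLetter s) ≡ (newState s , 1 ∷ ρ)
decodeStep-newPart {s = cyc zero} (invariant _ _ (inj₁ (() , _)) _ _)
decodeStep-newPart {s = cyc zero} (invariant _ _ (inj₂ (_ , () , _)) _ _)
decodeStep-newPart {s = cyc (suc zero)} _ = refl
decodeStep-newPart {s = cyc (suc (suc n))} _ = refl
decodeStep-newPart {s = blk N a zero y} _ = refl
decodeStep-newPart {s = blk N a (suc x) y} (invariant _ (_ , 1≤y) _ _ _)
  rewrite ≢⇒≡ᵇ-false (>⇒≢ (s≤s (m<m+n a 1≤y))) = refl

decodeStep-growPart : ∀ {f s r ρ} → Invariant (f , s) (suc r ∷ ρ) → Linked _≤_ (suc (suc r) ∷ ρ)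
  → decodeStep (s , suc r ∷ ρ) (growLetter s) ≡ (growState s , suc (suc r) ∷ ρ)
decodeStep-growPart {s = cyc N} (invariant _ _ (inj₁ (_ , ())) _ _) _
decodeStep-growPart {s = cyc N} (invariant _ _ (inj₂ (r , refl , refl)) _ _) _ = refl
decodeStep-growPart {s = blk N a zero y} (invariant _ _ (rest , refl) _ _) (y<y ∷ _) = ⊥-elim (<-irrefl refl y<y)
decodeStep-growPart {s = blk N a (suc x) y} (invariant _ _ (rest , refl) _ _) _ rewrite ≡ᵇ-refl a = refl

decode-newPart : ∀ {f s ρ} → Invariant (f , s) ρ → decode f ≡ (s , ρ)
  → decode (proj₁ (newPart (f , s))) ≡ (newState s , 1 ∷ ρ)
decode-newPart {f} {s} I decode-f with inv-last I
... | g , refl = begin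
  decode (g ∷ʳ lastLetter s ∷ʳ newLetter s)  ≡⟨ decode-∷ʳ g (lastLetter s) (newLetter s) ⟩
  decodeStep (decode f) (newLetter s)        ≡⟨ cong (λ d → decodeStep d (newLetter s)) decode-f ⟩
  decodeStep (s , _) (newLetter s)           ≡⟨ decodeStep-newPart I ⟩
  (newState s , 1 ∷ _)                       ∎
  where open ≡-Reasoning

decode-growPart : ∀ {f s r ρ} → Invariant (f , s) (suc r ∷ ρ) → Linked _≤_ (suc (suc r) ∷ ρ)
  → decode f ≡ (s , suc r ∷ ρ) → decode (proj₁ (growPart (f , s))) ≡ (growState s , suc (suc r) ∷ ρ)
decode-growPart {f} {s} I lnk decode-f with inv-last I
... | g , refl = begin
  decode (g ∷ʳ lastLetter s ∷ʳ growLetter s)  ≡⟨ decode-∷ʳ g (lastLetter s) (growLetter s) ⟩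
  decodeStep (decode f) (growLetter s)        ≡⟨ cong (λ d → decodeStep d (growLetter s)) decode-f ⟩
  decodeStep (s , _) (growLetter s)           ≡⟨ decodeStep-growPart I lnk ⟩
  (growState s , _)                           ∎
  where open ≡-Reasoning

decode-∷ : ∀ r ρ → Linked _≤_ (suc r ∷ ρ) → Invariant (encode ρ) ρ
  → decode (proj₁ (encode ρ)) ≡ (proj₂ (encode ρ) , ρ)
  → decode (proj₁ (encode (suc r ∷ ρ))) ≡ (proj₂ (encode (suc r ∷ ρ)) , suc r ∷ ρ)
decode-∷ zero ρ _ I dec = decode-newPart I dec
decode-∷ (suc r) [] _ I dec = decode-growPart (invariant-∷ r [] [-] I) [-] (decode-∷ r [] [-] I dec)
decode-∷ (suc r) (q ∷ ρ) (r<q ∷ lnk) I dec =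
  decode-growPart (invariant-∷ r (q ∷ ρ) lnk' I) (r<q ∷ lnk) (decode-∷ r (q ∷ ρ) lnk' I dec)
  where lnk' = ≤-trans (n≤1+n _) r<q ∷ lnk

decode-encode : ∀ ρ → Ascending ρ → decode (proj₁ (encode ρ)) ≡ (proj₂ (encode ρ) , ρ)
decode-encode [] _ = refl
decode-encode (zero ∷ ρ) (() ∷ _ , _)
decode-encode (suc r ∷ ρ) (_ ∷ pos , lnk) =
  decode-∷ r ρ lnk (encode-invariant ρ (pos , Linked.tail lnk)) (decode-encode ρ (pos , Linked.tail lnk))

encode-injective : ∀ {ρ ρ'} → Ascending ρ → Ascending ρ' → proj₁ (encode ρ) ≡ proj₁ (encode ρ') → ρ ≡ ρ'
encode-injective {ρ} {ρ'} asc asc' e = begin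
  ρ                                   ≡⟨ cong proj₂ (decode-encode ρ asc) ⟨
  proj₂ (decode (proj₁ (encode ρ)))   ≡⟨ cong (proj₂ ∘ decode) e ⟩
  proj₂ (decode (proj₁ (encode ρ')))  ≡⟨ cong proj₂ (decode-encode ρ' asc') ⟩
  ρ'                                  ∎
  where open ≡-Reasoning

linked-reverseAcc : ∀ {A : Set} {R : A → A → Set} x acc xs → Linked (flip R) (x ∷ acc) → Linked R (x ∷ xs)
  → Linked (flip R) (reverseAcc (x ∷ acc) xs)
linked-reverseAcc x acc [] racc _ = racc
linked-reverseAcc x acc (y ∷ xs) racc (r ∷ rs) = linked-reverseAcc y (x ∷ acc) xs (r ∷ racc) rs

linked-reverse : ∀ {A : Set} {R : A → A → Set} xs → Linked R xs → Linked (flip R) (reverse xs)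
linked-reverse [] _ = []
linked-reverse (x ∷ xs) lnk = linked-reverseAcc x [] xs [-] lnk

partition⇒ascending : ∀ {m λs} → Partition m λs → Ascending (reverse λs) × sum (reverse λs) ≡ m
partition⇒ascending {m} {λs} (pos , lnk , sum≡) =
  (All-resp-↭ (↭-sym (↭-reverse λs)) pos , linked-reverse λs lnk) , trans (sum-↭ (↭-reverse λs)) sum≡

ascending⇒partition : ∀ {ρ} → Ascending ρ → Partition (sum ρ) (reverse ρ)
ascending⇒partition {ρ} (pos , lnk) = All-resp-↭ (↭-sym (↭-reverse ρ)) pos , linked-reverse ρ lnk , sum-↭ (↭-reverse ρ)

fromPartition : List ℕ → List ℕ
fromPartition λs = proj₁ (encode (reverse λs))

fromPartition-injective : ∀ {m λs μs} → Partition m λs → Partition m μs → fromPartition λs ≡ fromPartition μs → λs ≡ μs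
fromPartition-injective P Q e =
  reverse-injective (encode-injective (proj₁ (partition⇒ascending P)) (proj₁ (partition⇒ascending Q)) e)

shape-invariants : ∀ {f} s → ShapeOf f s → BoundedBy (φ f) (size s) × FixedAbove (φ f) (size s) × Avoids132 (size s) (φ f)
shape-invariants (cyc N) (C , _) = cycle-bounded C , cycle-fixedAbove C , cycle-avoids132 C
shape-invariants (blk N a x y) (R , _) = block-bounded R , block-fixedAbove R , block-avoids132 R

encode-nomCode132 : ∀ {ρ} → Ascending ρ → NomCode132 (suc (sum ρ)) (proj₁ (encode ρ))
encode-nomCode132 {ρ} asc =
  subst (λ N → NomCode132 N (proj₁ (encode ρ))) (inv-size I) (inv-code I , proj₂ (proj₂ (shape-invariants _ (inv-shape I))))
  where I = encode-invariant ρ asc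

encode-size : ∀ {N ρ} → Ascending ρ → NonDecSubexceedant N (proj₁ (encode ρ)) → suc (sum ρ) ≡ N
encode-size {N} {ρ} asc code = trans (sym (inv-size I)) (trans (sym (nonDec-length (inv-code I))) (nonDec-length code))
  where I = encode-invariant ρ asc

lastLetter<size : ∀ {f s ρ} → Invariant (f , s) ρ → ρ ≢ [] → lastLetter s < size s
lastLetter<size {s = cyc N} (invariant _ _ (inj₁ (_ , ρ≡[])) _ _) ρ≢[] = ⊥-elim (ρ≢[] ρ≡[])
lastLetter<size {s = cyc N} (invariant _ _ (inj₂ (r , refl , _)) _ _) _ = s≤s (s≤s z≤n)
lastLetter<size {s = blk N a x y} I _ = subst (suc a ≤_) (block-size R) (+-monoˡ-≤ a (blocks-nonempty R))
  where R = proj₁ (inv-shape I)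

encode-last : ∀ {ρ} → Ascending ρ → ρ ≢ [] → Σ (List ℕ) λ g → Σ ℕ λ L → proj₁ (encode ρ) ≡ g ∷ʳ L × L < suc (sum ρ)
encode-last {ρ} asc ρ≢[] with encode-invariant ρ asc
... | I with inv-last I
...   | g , e = g , _ , e , subst (lastLetter (proj₂ (encode ρ)) <_) (inv-size I) (lastLetter<size I ρ≢[])

avoider-bounded : ∀ {M g} → NonDecSubexceedant (suc M) g → Avoids132 (suc M) (φ g)
  → BoundedBy (φ g) (suc M) × FixedAbove (φ g) (suc M)
avoider-bounded {M} {g} code av with classify M g code
... | encoded ρ asc refl with shape-invariants _ (inv-shape (encode-invariant ρ asc))
...   | bd , fx , _ = subst (BoundedBy (φ g)) N≡ bd , subst (FixedAbove (φ g)) N≡ fx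
  where N≡ = trans (inv-size (encode-invariant ρ asc)) (encode-size asc code)
avoider-bounded code av | topFixed F _ = top-bounded F , top-fixedAbove F
avoider-bounded code av | occurs132 _ occ _ _ _ = ⊥-elim (av (occurs132Below⇒contains occ))

avoids132-mono : ∀ {σ m n} → m ≤ n → Avoids132 n σ → Avoids132 m σ
avoids132-mono m≤n av (a , b , c , h₁ , h₂ , h₃ , c≤m , h₅) = av (a , b , c , h₁ , h₂ , h₃ , ≤-trans c≤m m≤n , h₅)

nomCode132-∷ʳ-top : ∀ {m g} → NomCode132 (suc m) g → NomCode132 (2 + m) (g ∷ʳ (2 + m))
nomCode132-∷ʳ-top {m} {g} (code , av) with ∷ʳ-view g m (nonDec-length code) | avoider-bounded code av
... | g' , L , refl , _ | bd , fx =
  nonDec-∷ʳ⁺ g' L (2 + m) code (m≤n⇒m≤1+n (proj₂ (proj₂ (nonDec-∷ʳ⁻ g' L code)))) (s≤s z≤n) ≤-refl ,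
  avoids132-resp-≗ (extend-φ g (2 + m) (suc m) (nonDec-length code)) (top-avoids132 (topFixed-extend (s≤s z≤n) bd fx av))

nomCode132-∷ʳ-top⁻ : ∀ {m g} → NomCode132 (2 + m) (g ∷ʳ (2 + m)) → NomCode132 (suc m) g
nomCode132-∷ʳ-top⁻ {m} {g} (code , av) = code' , avoids132-mono (n≤1+n (suc m)) (avoids132-resp-≗ φ≗ av)
  where
  code' = proj₁ (nonDec-∷ʳ⁻ g (2 + m) code)
  φ≗ : φ (g ∷ʳ (2 + m)) ≗ φ g
  φ≗ i rewrite φ-∷ʳ g (2 + m) i | nonDec-length code' = swap-diag (2 + m) (φ g i)

nomCode132-split : ∀ {m f} → NomCode132 (2 + m) f
  → (Σ (List ℕ) λ g → NomCode132 (suc m) g × g ∷ʳ (2 + m) ≡ f)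
  ⊎ (Σ (List ℕ) λ λs → Partition (suc m) λs × fromPartition λs ≡ f)
nomCode132-split {m} {f} (code , av) with classify (suc m) f code
... | encoded ρ asc refl = inj₂ (reverse ρ , P , cong (proj₁ ∘ encode) (reverse-involutive ρ))
  where
  P : Partition (suc m) (reverse ρ)
  P = subst (λ k → Partition k (reverse ρ)) (cong pred (encode-size asc code)) (ascending⇒partition asc)
... | topFixed _ (g , refl) = inj₁ (g , nomCode132-∷ʳ-top⁻ (code , av) , refl)
... | occurs132 _ occ _ _ _ = ⊥-elim (av (occurs132Below⇒contains occ))

partition-nomCode132 : ∀ {m λs} → Partition m λs → NomCode132 (suc m) (fromPartition λs)
partition-nomCode132 {m} {λs} P with partition⇒ascending P
... | asc , sum≡ = subst (λ k → NomCode132 (suc k) (fromPartition λs)) sum≡ (encode-nomCode132 asc)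

nomCode132-join : ∀ {m f} → (Σ (List ℕ) λ g → NomCode132 (suc m) g × g ∷ʳ (2 + m) ≡ f)
  ⊎ (Σ (List ℕ) λ λs → Partition (suc m) λs × fromPartition λs ≡ f) → NomCode132 (2 + m) f
nomCode132-join (inj₁ (g , C , refl)) = nomCode132-∷ʳ-top C
nomCode132-join (inj₂ (λs , P , refl)) = partition-nomCode132 P

topCode≢fromPartition : ∀ {m g λs} → Partition (suc m) λs → g ∷ʳ (2 + m) ≢ fromPartition λs
topCode≢fromPartition {m} {g} {λs} P e with partition⇒ascending P
... | asc , sum≡ with encode-last asc (λ ρ≡[] → 0≢1+n (trans (sym (cong sum ρ≡[])) sum≡))
...   | g' , L , e' , L< = <-irrefl (sym (proj₂ (∷ʳ-injective g g' (trans e e')))) (subst (L <_) (cong suc sum≡) L<)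

unique-map⁺ : ∀ {A B : Set} {f : A → B} (xs : List A) → Unique xs
  → (∀ {x y} → x ∈ xs → y ∈ xs → f x ≡ f y → x ≡ y) → Unique (map f xs)
unique-map⁺ [] [] _ = []
unique-map⁺ {f = f} (x ∷ xs) (x∉xs ∷ uxs) inj =
  fresh xs x∉xs (λ y∈ → inj (here refl) (there y∈)) ∷ unique-map⁺ xs uxs (λ x∈ y∈ → inj (there x∈) (there y∈))
  where
  fresh : ∀ ys → All (x ≢_) ys → (∀ {y} → y ∈ ys → f x ≡ f y → x ≡ y) → All (f x ≢_) (map f ys)
  fresh [] [] _ = []
  fresh (y ∷ ys) (x≢y ∷ x≢ys) inj′ = (x≢y ∘ inj′ (here refl)) ∷ fresh ys x≢ys (inj′ ∘ there)

hasCard-images : ∀ {P Q R : List ℕ → Set} {a b} (f g : List ℕ → List ℕ) → HasCard Q a → HasCard R b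
  → (∀ {x y} → Q x → Q y → f x ≡ f y → x ≡ y) → (∀ {x y} → R x → R y → g x ≡ g y → x ≡ y)
  → (∀ {x y} → Q x → R y → f x ≢ g y)
  → (∀ z → P z ⇔ ((Σ (List ℕ) λ x → Q x × f x ≡ z) ⊎ (Σ (List ℕ) λ y → R y × g y ≡ z)))
  → HasCard P (a + b)
hasCard-images {P} {Q} {R} f g (xs , uxs , len-xs , ∈xs) (ys , uys , len-ys , ∈ys) f-inj g-inj disjoint P⇔ =
  map f xs ++ map g ys ,
  Unique.++⁺ (unique-map⁺ xs uxs (λ x∈ y∈ → f-inj (inQ x∈) (inQ y∈)))
             (unique-map⁺ ys uys (λ x∈ y∈ → g-inj (inR x∈) (inR y∈))) apart ,
  trans (length-++ (map f xs)) (cong₂ _+_ (trans (length-map f xs) len-xs) (trans (length-map g ys) len-ys)) ,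
  λ z → mk⇔ (sound z) (complete z)
  where
  inQ : ∀ {x} → x ∈ xs → Q x
  inQ {x} = Equivalence.to (∈xs x)
  inR : ∀ {y} → y ∈ ys → R y
  inR {y} = Equivalence.to (∈ys y)
  apart : ∀ {z} → ¬ (z ∈ map f xs × z ∈ map g ys)
  apart (z∈f , z∈g) with ∈-map⁻ f z∈f | ∈-map⁻ g z∈g
  ... | x , x∈ , refl | y , y∈ , e = disjoint (inQ x∈) (inR y∈) e
  sound : ∀ z → z ∈ map f xs ++ map g ys → P z
  sound z z∈ with ∈-++⁻ (map f xs) z∈
  ... | inj₁ z∈f = let (x , x∈ , e) = ∈-map⁻ f z∈f in Equivalence.from (P⇔ z) (inj₁ (x , inQ x∈ , sym e))
  ... | inj₂ z∈g = let (y , y∈ , e) = ∈-map⁻ g z∈g in Equivalence.from (P⇔ z) (inj₂ (y , inR y∈ , sym e))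
  complete : ∀ z → P z → z ∈ map f xs ++ map g ys
  complete z Pz with Equivalence.to (P⇔ z) Pz
  ... | inj₁ (x , Qx , refl) = ∈-++⁺ˡ (∈-map⁺ f (Equivalence.from (∈xs x) Qx))
  ... | inj₂ (y , Ry , refl) = ∈-++⁺ʳ (map f xs) (∈-map⁺ g (Equivalence.from (∈ys y) Ry))

nomCodes-1 : HasCard (NomCode132 1) 1
nomCodes-1 = (1 ∷ []) ∷ [] , [] ∷ [] , refl , λ f → mk⇔ (sound f) (complete f)
  where
  sound : ∀ f → f ∈ (1 ∷ []) ∷ [] → NomCode132 1 f
  sound f (here refl) = ((refl , (s≤s z≤n , s≤s z≤n) , tt) , [-]) ,
    λ (a , b , c , 1≤a , a<b , b<c , c≤1 , _) → 3≰1 (≤-trans (≤-trans (s≤s (≤-trans (s≤s 1≤a) a<b)) b<c) c≤1)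
    where
    3≰1 : ¬ 3 ≤ 1
    3≰1 (s≤s ())
  complete : ∀ f → NomCode132 1 f → f ∈ (1 ∷ []) ∷ []
  complete (suc zero ∷ []) _ = here refl
  complete (zero ∷ []) (((_ , (() , _) , _) , _) , _)
  complete (suc (suc x) ∷ []) (((_ , (_ , s≤s ()) , _) , _) , _)

nomCodes-step : (n : ℕ) → 2 ≤ n → (a p : ℕ) → HasCard (NomCode132 (n ∸ 1)) a → HasCard (Partition (n ∸ 1)) p
  → HasCard (NomCode132 n) (a + p)
nomCodes-step (suc zero) (s≤s ()) _ _ _ _
nomCodes-step (suc (suc m)) _ a p codes partitions =
  hasCard-images (_∷ʳ (2 + m)) fromPartition codes partitions
    (λ {g} {h} _ _ e → proj₁ (∷ʳ-injective g h e)) fromPartition-injective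
    (λ _ P → topCode≢fromPartition P)
    (λ _ → mk⇔ nomCode132-split nomCode132-join)
theorem5p1 : HasCard (NomCode132 1) 1
    × ((n : ℕ) → 2 ≤ n → (a p : ℕ)
    → HasCard (NomCode132 (n ∸ 1)) a
    → HasCard (Partition (n ∸ 1)) p
    → HasCard (NomCode132 n) (a + p))
theorem5p1 = nomCodes-1 , nomCodes-step
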